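{- Fix an integer $n\geq 2$. The sequence $c_{n,0},c_{n,1},\ldots,c_{n,\lfloor n/2\rfloor-1}$ is strictly log concave: for all integers $i$ with $0<i<\lfloor n/2\rfloor-1$, we have $c_{n,i}^2>c_{n,i-1}\,c_{n,i+1}$.
   Context: Let $U_n=\{z\in(\mathbb{C}^\times)^n : \frac1{z_1}+\cdots+\frac1{z_n}=0\}$ and let $X_n$ be its closure in $\mathbb{C}^n$. $\operatorname{IH}^*(X_n)$ denotes intersection cohomology with complex coefficients, and $c_{n,i}:=\dim\operatorname{IH}^{2i}(X_n)$ (these are the coefficients of the Kazhdan–Lusztig polynomial of the uniform matroid of rank $n-1$ on $n$ elements). -}

module Defs where

open import Data.Nat as ℕ using (ℕ; zero; suc; _∸_; _≤?_)
open import Data.Nat.Combinatorics using (_C_)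
open import Data.Integer as ℤ using (ℤ; +_; -_; _+_; _*_)
open import Relation.Nullary using (yes; no)
open import Data.Bool using (if_then_else_)
open import Relation.Nullary.Decidable using (⌊_⌋)

sumTo : ℕ → (ℕ → ℤ) → ℤ
sumTo zero    f = + 0
sumTo (suc n) f = sumTo n f + f n

sgn : ℕ → ℤ
sgn zero    = + 1
sgn (suc e) = - sgn e

δ : ℕ → ℕ → ℤ
δ a b with a ℕ.≟ b
... | yes _ = + 1
... | no  _ = + 0

-- Polynomials in t with integer coefficients are represented by their
-- coefficient functions ℕ → ℤ (coefficient of t^i).

-- Characteristic polynomial of the uniform matroid U_{r,m} (rank r on m
-- elements), via  χ_M(t) = Σ_{A ⊆ E} (-1)^{|A|} t^{rk M - rk A},
-- with rk A = min(|A|, r).  Coefficient of t^i: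
χU : (r m : ℕ) → ℕ → ℤ
χU r m i = sumTo (suc m) λ j → sgn j * (+ (m C j)) * δ (r ∸ ℕ._⊓_ j r) i

-- Coefficient of t^a in (t - 1)^k.
tm1 : ℕ → ℕ → ℤ
tm1 k a = sgn (k ∸ a) * (+ (k C a))

-- Given (prev s m) = KL polynomial of U_{s,m} for all s < r, the right-hand
-- side of the defining recursion of Elias–Proudfoot–Wakefield,
--   t^r P_M(t^{-1}) - P_M(t) = Σ_{∅ ≠ F flat} χ_{M_F}(t) P_{M^F}(t),
-- specialised to M = U_{r,m}: the nonempty flats are the k-subsets with
-- 1 ≤ k ≤ r-1 (restriction = Boolean U_{k,k}, χ = (t-1)^k, contraction
-- U_{r-k,m-k}) together with E itself (restriction M, contraction of rank 0,
-- KL polynomial 1).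
rhs : (ℕ → ℕ → ℕ → ℤ) → (r m : ℕ) → ℕ → ℤ
rhs prev r m i =
  sumTo r (λ k → if ⌊ 1 ℕ.≤? k ⌋
                   then (+ (m C k)) * sumTo (suc i) (λ a → tm1 k a * prev (r ∸ k) (m ∸ k) (i ∸ a))
                   else + 0)
  + χU r m i

-- The KL polynomial of U_{r,m} (rank r ≥ 1) is the unique P with deg P < r/2
-- satisfying t^r P(t^{-1}) - P(t) = rhs; since t^r P(t^{-1}) only has terms of
-- degree > r/2, its coefficient of t^i is -rhs_i for 2i < r and 0 otherwise.
-- KLall R s m i = coefficient of t^i of P_{U_{s,m}} for s ≤ R.
KLall : ℕ → ℕ → ℕ → ℕ → ℤ
KLall zero    s m i = δ i 0
KLall (suc R) s m i with s ≤? R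
... | yes _ = KLall R s m i
... | no  _ with suc (i ℕ.+ i) ≤? s
...   | yes _ = - rhs (KLall R) s m i
...   | no  _ = + 0

KLU : (r m : ℕ) → ℕ → ℤ
KLU r m i = KLall r r m i

c : ℕ → ℕ → ℤ
c n i = KLU (n ∸ 1) n i

-- The coefficients have the closed form (i + 1) c_{n,i} = C(n,i) C(n-i-2,i), proved by strong induction on n.
-- The contraction of U_{n-1,n} at a flat of size k is U_{n-k-1,n-k}, so the defining recursion expresses c_{n,i}
-- through the c_{n-k,j} with k ≥ 1. Substituting their closed forms and writing k = a + b, the sum over b is the
-- alternating binomial sum Σ_b (-1)^b C(p,b) C(L-b,j) = (-1)^(L-j) C(p-j-1,L-j); the remaining alternating sum
-- over a then cancels the characteristic polynomial term up to C(n,i) C(n-i-2,i).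
-- By the closed form, c_{n,i+1} / c_{n,i} = (n-i)(n-2i-2)(n-2i-3) / ((i+1)(i+2)(n-i-2)). This ratio strictly
-- decreases from i to i + 1 whenever 2i + 6 ≤ n, and a positive sequence with strictly decreasing ratios is
-- strictly log-concave.
module Submission where

open import Defs

module FiniteSums where
  open import Data.Nat as ℕ using (ℕ; zero; suc; _<_)
  import Data.Nat.Properties as ℕₚ
  open import Data.Integer using (ℤ; +_; -_; _+_; _*_)
  import Data.Integer.Properties as ℤₚ
  open import Data.Integer.Tactic.RingSolver using (solve-∀)
  open import Relation.Binary.PropositionalEquality
  open import Relation.Nullary using (yes; no)
  open import Function using (_∘_)

  private
    interchange : ∀ a b c d → (a + b) + (c + d) ≡ (a + c) + (b + d)
    interchange = solve-∀

  sumTo-cong : ∀ n {f g : ℕ → ℤ} → (∀ k → k < n → f k ≡ g k) → sumTo n f ≡ sumTo n g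
  sumTo-cong zero    f≗g = refl
  sumTo-cong (suc n) f≗g =
    cong₂ _+_ (sumTo-cong n (λ k k<n → f≗g k (ℕₚ.m<n⇒m<1+n k<n))) (f≗g n (ℕₚ.n<1+n n))

  sumTo-zero : ∀ n {f : ℕ → ℤ} → (∀ k → k < n → f k ≡ + 0) → sumTo n f ≡ + 0
  sumTo-zero zero    f≗0 = refl
  sumTo-zero (suc n) f≗0 =
    cong₂ _+_ (sumTo-zero n (λ k k<n → f≗0 k (ℕₚ.m<n⇒m<1+n k<n))) (f≗0 n (ℕₚ.n<1+n n))

  sumTo-distrib-+ : ∀ n (f g : ℕ → ℤ) → sumTo n (λ k → f k + g k) ≡ sumTo n f + sumTo n g
  sumTo-distrib-+ zero    f g = refl
  sumTo-distrib-+ (suc n) f g =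
    trans (cong (_+ (f n + g n)) (sumTo-distrib-+ n f g)) (interchange (sumTo n f) (sumTo n g) (f n) (g n))

  *-distribˡ-sumTo : ∀ n x (f : ℕ → ℤ) → x * sumTo n f ≡ sumTo n (λ k → x * f k)
  *-distribˡ-sumTo zero    x f = ℤₚ.*-zeroʳ x
  *-distribˡ-sumTo (suc n) x f =
    trans (ℤₚ.*-distribˡ-+ x (sumTo n f) (f n)) (cong (_+ x * f n) (*-distribˡ-sumTo n x f))

  neg-distrib-sumTo : ∀ n (f : ℕ → ℤ) → - sumTo n f ≡ sumTo n (λ k → - f k)
  neg-distrib-sumTo zero    f = refl
  neg-distrib-sumTo (suc n) f =
    trans (ℤₚ.neg-distrib-+ (sumTo n f) (f n)) (cong (_+ - f n) (neg-distrib-sumTo n f))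

  sumTo-comm : ∀ m n (f : ℕ → ℕ → ℤ) →
               sumTo m (λ k → sumTo n (f k)) ≡ sumTo n (λ a → sumTo m (λ k → f k a))
  sumTo-comm zero    n f = sym (sumTo-zero n (λ _ _ → refl))
  sumTo-comm (suc m) n f = begin
    sumTo m (λ k → sumTo n (f k)) + sumTo n (f m)        ≡⟨ cong (_+ sumTo n (f m)) (sumTo-comm m n f) ⟩
    sumTo n (λ a → sumTo m (λ k → f k a)) + sumTo n (f m) ≡⟨ sumTo-distrib-+ n _ (f m) ⟨
    sumTo n (λ a → sumTo (suc m) (λ k → f k a))           ∎
    where open ≡-Reasoning

  sumTo-split : ∀ m n (f : ℕ → ℤ) → sumTo (m ℕ.+ n) f ≡ sumTo m f + sumTo n (λ k → f (m ℕ.+ k))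
  sumTo-split m zero    f = trans (cong (λ l → sumTo l f) (ℕₚ.+-identityʳ m)) (sym (ℤₚ.+-identityʳ _))
  sumTo-split m (suc n) f = begin
    sumTo (m ℕ.+ suc n) f                                        ≡⟨ cong (λ l → sumTo l f) (ℕₚ.+-suc m n) ⟩
    sumTo (m ℕ.+ n) f + f (m ℕ.+ n)                              ≡⟨ cong (_+ f (m ℕ.+ n)) (sumTo-split m n f) ⟩
    sumTo m f + sumTo n (λ k → f (m ℕ.+ k)) + f (m ℕ.+ n)        ≡⟨ ℤₚ.+-assoc (sumTo m f) _ _ ⟩
    sumTo m f + sumTo (suc n) (λ k → f (m ℕ.+ k))                ∎
    where open ≡-Reasoning

  sumTo-head : ∀ n (f : ℕ → ℤ) → sumTo (suc n) f ≡ f 0 + sumTo n (λ k → f (suc k))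
  sumTo-head n f = trans (sumTo-split 1 n f) (cong (_+ sumTo n (λ k → f (suc k))) (ℤₚ.+-identityˡ (f 0)))

  sumTo-single : ∀ n p {f : ℕ → ℤ} → p < n → (∀ k → k < n → k ≢ p → f k ≡ + 0) → sumTo n f ≡ f p
  sumTo-single (suc n) p {f} p<1+n f≗0 with p ℕ.≟ n
  ... | yes refl = trans (cong (_+ f p) (sumTo-zero n λ k k<n → f≗0 k (ℕₚ.m<n⇒m<1+n k<n) (ℕₚ.<⇒≢ k<n)))
                         (ℤₚ.+-identityˡ (f p))
  ... | no  p≢n  = trans (cong₂ _+_ (sumTo-single n p (ℕₚ.≤∧≢⇒< (ℕₚ.≤-pred p<1+n) p≢n)
                                                      (λ k k<n → f≗0 k (ℕₚ.m<n⇒m<1+n k<n)))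
                                    (f≗0 n (ℕₚ.n<1+n n) (p≢n ∘ sym)))
                         (ℤₚ.+-identityʳ (f p))

module Binomial where
  open import Data.Nat
  open import Data.Nat.Properties
  open import Data.Nat.Combinatorics
  open import Data.Nat.DivMod using (m/n*n≡m)
  open import Data.Nat.Tactic.RingSolver using (solve-∀)
  open import Relation.Binary.PropositionalEquality
  open import Relation.Nullary using (contradiction; yes; no)
  open import Function using (_∘_)
  open ≡-Reasoning

  nCk*k!*[n∸k]!≡n! : ∀ {n k} → k ≤ n → (n C k) * (k ! * (n ∸ k) !) ≡ n !
  nCk*k!*[n∸k]!≡n! {n} {k} k≤n = begin
    (n C k) * (k ! * (n ∸ k) !)                    ≡⟨ cong (_* (k ! * (n ∸ k) !)) (nCk≡n!/k![n-k]! k≤n) ⟩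
    n ! / (k ! * (n ∸ k) !) * (k ! * (n ∸ k) !)    ≡⟨ m/n*n≡m (k![n∸k]!∣n! k≤n) ⟩
    n !                                            ∎
    where instance _ = k !* (n ∸ k) !≢0

  [m+n]Cm*m!*n!≡[m+n]! : ∀ m n → ((m + n) C m) * (m ! * n !) ≡ (m + n) !
  [m+n]Cm*m!*n!≡[m+n]! m n =
    subst (λ l → ((m + n) C m) * (m ! * l !) ≡ (m + n) !) (m+n∸m≡n m n) (nCk*k!*[n∸k]!≡n! (m≤m+n m n))

  [m+n]Cm≡[m+n]Cn : ∀ m n → (m + n) C m ≡ (m + n) C n
  [m+n]Cm≡[m+n]Cn m n = trans (nCk≡nC[n∸k] (m≤m+n m n)) (cong ((m + n) C_) (m+n∸m≡n m n))

  nCk>0 : ∀ {n k} → k ≤ n → 0 < n C k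
  nCk>0 {n} {k} k≤n with n C k in eq
  ... | suc _ = s≤s z≤n
  ... | zero  = contradiction (trans (cong (_* (k ! * (n ∸ k) !)) (sym eq)) (nCk*k!*[n∸k]!≡n! k≤n))
                              (≢-nonZero⁻¹ (n !) ∘ sym)
    where instance _ = n !≢0

  private
    trinomial-factorials : ∀ x y r →
      ((x + y + r) C (x + y)) * ((x + y) C x) * (x ! * y ! * r !) ≡ (x + y + r) !
    trinomial-factorials x y r = begin
      ((x + y + r) C (x + y)) * ((x + y) C x) * (x ! * y ! * r !)
        ≡⟨ regroup ((x + y + r) C (x + y)) ((x + y) C x) (x !) (y !) (r !) ⟩
      ((x + y + r) C (x + y)) * (((x + y) C x) * (x ! * y !) * r !)
        ≡⟨ cong (λ z → ((x + y + r) C (x + y)) * (z * r !)) ([m+n]Cm*m!*n!≡[m+n]! x y) ⟩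
      ((x + y + r) C (x + y)) * ((x + y) ! * r !)
        ≡⟨ [m+n]Cm*m!*n!≡[m+n]! (x + y) r ⟩
      (x + y + r) ! ∎
      where
      regroup : ∀ a b u v w → a * b * (u * v * w) ≡ a * (b * (u * v) * w)
      regroup = solve-∀

    trinomial-factorials′ : ∀ x y r →
      ((x + y + r) C x) * ((y + r) C y) * (x ! * y ! * r !) ≡ (x + y + r) !
    trinomial-factorials′ x y r = begin
      ((x + y + r) C x) * ((y + r) C y) * (x ! * y ! * r !)
        ≡⟨ regroup ((x + y + r) C x) ((y + r) C y) (x !) (y !) (r !) ⟩
      ((x + y + r) C x) * (x ! * (((y + r) C y) * (y ! * r !)))
        ≡⟨ cong (λ z → ((x + y + r) C x) * (x ! * z)) ([m+n]Cm*m!*n!≡[m+n]! y r) ⟩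
      ((x + y + r) C x) * (x ! * (y + r) !)
        ≡⟨ cong (λ l → (l C x) * (x ! * (y + r) !)) (+-assoc x y r) ⟩
      ((x + (y + r)) C x) * (x ! * (y + r) !)
        ≡⟨ [m+n]Cm*m!*n!≡[m+n]! x (y + r) ⟩
      (x + (y + r)) !
        ≡⟨ cong _! (+-assoc x y r) ⟨
      (x + y + r) ! ∎
      where
      regroup : ∀ a b u v w → a * b * (u * v * w) ≡ a * (u * (b * (v * w)))
      regroup = solve-∀

  nC[x+y]*[x+y]Cx≡nCx*[n∸x]Cy : ∀ n x y → (n C (x + y)) * ((x + y) C x) ≡ (n C x) * ((n ∸ x) C y)
  nC[x+y]*[x+y]Cx≡nCx*[n∸x]Cy n x y with x + y ≤? n
  ... | yes x+y≤n = subst (λ l → (l C (x + y)) * ((x + y) C x) ≡ (l C x) * ((l ∸ x) C y)) (m+[n∸m]≡n x+y≤n) (begin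
      ((x + y + r) C (x + y)) * ((x + y) C x)
        ≡⟨ *-cancelʳ-≡ _ _ (x ! * y ! * r !) (trans (trinomial-factorials x y r) (sym (trinomial-factorials′ x y r))) ⟩
      ((x + y + r) C x) * ((y + r) C y)
        ≡⟨ cong (λ l → ((x + y + r) C x) * (l C y)) (x+y+r∸x≡y+r) ⟨
      ((x + y + r) C x) * ((x + y + r ∸ x) C y) ∎)
    where
    r = n ∸ (x + y)
    instance _ = m*n≢0 (x ! * y !) (r !) {{x !* y !≢0}} {{r !≢0}}
    x+y+r∸x≡y+r : x + y + r ∸ x ≡ y + r
    x+y+r∸x≡y+r = trans (cong (_∸ x) (+-assoc x y r)) (m+n∸m≡n x (y + r))
  ... | no x+y≰n with x ≤? n
  ...   | no x≰n  = trans (cong (_* ((x + y) C x)) (k>n⇒nCk≡0 (≰⇒> x+y≰n)))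
                          (sym (cong (_* ((n ∸ x) C y)) (k>n⇒nCk≡0 (≰⇒> x≰n))))
  ...   | yes x≤n = trans (cong (_* ((x + y) C x)) (k>n⇒nCk≡0 (≰⇒> x+y≰n)))
                          (sym (trans (cong ((n C x) *_) (k>n⇒nCk≡0 n∸x<y)) (*-zeroʳ (n C x))))
    where
    n∸x<y : n ∸ x < y
    n∸x<y = +-cancelˡ-< x (n ∸ x) y (subst (_< x + y) (sym (m+[n∸m]≡n x≤n)) (≰⇒> x+y≰n))

  [1+n]Cn≡1+n : ∀ n → suc n C n ≡ suc n
  [1+n]Cn≡1+n n = subst (λ l → l C n ≡ l) (+-comm n 1) (trans ([m+n]Cm≡[m+n]Cn n 1) (nC1≡n (n + 1)))

  [1+n]C[1+k]*[1+k]≡[1+n]*nCk : ∀ n k → (suc n C suc k) * suc k ≡ suc n * (n C k)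
  [1+n]C[1+k]*[1+k]≡[1+n]*nCk n k = begin
    (suc n C suc k) * suc k           ≡⟨ cong ((suc n C suc k) *_) (nC1≡n (suc k)) ⟨
    (suc n C (1 + k)) * ((1 + k) C 1) ≡⟨ nC[x+y]*[x+y]Cx≡nCx*[n∸x]Cy (suc n) 1 k ⟩
    (suc n C 1) * (n C k)             ≡⟨ cong (_* (n C k)) (nC1≡n (suc n)) ⟩
    suc n * (n C k)                   ∎

  nC[1+k]*[1+k]≡nCk*[n∸k] : ∀ n k → (n C suc k) * suc k ≡ (n C k) * (n ∸ k)
  nC[1+k]*[1+k]≡nCk*[n∸k] n k = begin
    (n C suc k) * suc k             ≡⟨ cong (λ l → (n C l) * l) (+-comm 1 k) ⟩
    (n C (k + 1)) * (k + 1)         ≡⟨ cong ((n C (k + 1)) *_) (subst (λ l → l C k ≡ l) (+-comm 1 k) ([1+n]Cn≡1+n k)) ⟨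
    (n C (k + 1)) * ((k + 1) C k)   ≡⟨ nC[x+y]*[x+y]Cx≡nCx*[n∸x]Cy n k 1 ⟩
    (n C k) * ((n ∸ k) C 1)         ≡⟨ cong ((n C k) *_) (nC1≡n (n ∸ k)) ⟩
    (n C k) * (n ∸ k)               ∎

  n*[n∸1]Ck≡nCk*[n∸k] : ∀ n k → n * ((n ∸ 1) C k) ≡ (n C k) * (n ∸ k)
  n*[n∸1]Ck≡nCk*[n∸k] n k = begin
    n * ((n ∸ 1) C k)             ≡⟨ cong (_* ((n ∸ 1) C k)) (nC1≡n n) ⟨
    (n C 1) * ((n ∸ 1) C k)       ≡⟨ nC[x+y]*[x+y]Cx≡nCx*[n∸x]Cy n 1 k ⟨
    (n C suc k) * (suc k C 1)     ≡⟨ cong ((n C suc k) *_) (nC1≡n (suc k)) ⟩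
    (n C suc k) * suc k           ≡⟨ nC[1+k]*[1+k]≡nCk*[n∸k] n k ⟩
    (n C k) * (n ∸ k)             ∎

  nC[a+b]*[a+b]Ca*[n∸[a+b]]Cj≡nCa*[n∸a]C[b+j]*[b+j]Cb : ∀ n a b j →
    (n C (a + b)) * ((a + b) C a) * ((n ∸ (a + b)) C j) ≡ (n C a) * (((n ∸ a) C (b + j)) * ((b + j) C b))
  nC[a+b]*[a+b]Ca*[n∸[a+b]]Cj≡nCa*[n∸a]C[b+j]*[b+j]Cb n a b j = begin
    (n C (a + b)) * ((a + b) C a) * ((n ∸ (a + b)) C j)
      ≡⟨ cong₂ (λ x l → x * (l C j)) (nC[x+y]*[x+y]Cx≡nCx*[n∸x]Cy n a b) (sym (∸-+-assoc n a b)) ⟩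
    (n C a) * ((n ∸ a) C b) * ((n ∸ a ∸ b) C j)
      ≡⟨ *-assoc (n C a) _ _ ⟩
    (n C a) * (((n ∸ a) C b) * ((n ∸ a ∸ b) C j))
      ≡⟨ cong ((n C a) *_) (nC[x+y]*[x+y]Cx≡nCx*[n∸x]Cy (n ∸ a) b j) ⟨
    (n C a) * (((n ∸ a) C (b + j)) * ((b + j) C b)) ∎

  nC[a+b]*[a+b]Ca*[n∸[a+b]]Cj≡nC[a+j]*[a+j]Ca*[n∸[a+j]]Cb : ∀ n a b j →
    (n C (a + b)) * ((a + b) C a) * ((n ∸ (a + b)) C j) ≡ (n C (a + j)) * ((a + j) C a) * ((n ∸ (a + j)) C b)
  nC[a+b]*[a+b]Ca*[n∸[a+b]]Cj≡nC[a+j]*[a+j]Ca*[n∸[a+j]]Cb n a b j = begin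
    (n C (a + b)) * ((a + b) C a) * ((n ∸ (a + b)) C j)
      ≡⟨ nC[a+b]*[a+b]Ca*[n∸[a+b]]Cj≡nCa*[n∸a]C[b+j]*[b+j]Cb n a b j ⟩
    (n C a) * (((n ∸ a) C (b + j)) * ((b + j) C b))
      ≡⟨ cong (λ l → (n C a) * (((n ∸ a) C l) * (l C b))) (+-comm b j) ⟩
    (n C a) * (((n ∸ a) C (j + b)) * ((j + b) C b))
      ≡⟨ cong (λ x → (n C a) * (((n ∸ a) C (j + b)) * x)) ([m+n]Cm≡[m+n]Cn j b) ⟨
    (n C a) * (((n ∸ a) C (j + b)) * ((j + b) C j))
      ≡⟨ nC[a+b]*[a+b]Ca*[n∸[a+b]]Cj≡nCa*[n∸a]C[b+j]*[b+j]Cb n a j b ⟨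
    (n C (a + j)) * ((a + j) C a) * ((n ∸ (a + j)) C b) ∎

  [1+a+j]*[a+j]Ca≡[1+j]*[1+a+j]Ca : ∀ a j → suc (a + j) * ((a + j) C a) ≡ suc j * (suc (a + j) C a)
  [1+a+j]*[a+j]Ca≡[1+j]*[1+a+j]Ca a j = begin
    suc (a + j) * ((a + j) C a)      ≡⟨ cong (suc (a + j) *_) ([m+n]Cm≡[m+n]Cn a j) ⟩
    suc (a + j) * ((a + j) C j)      ≡⟨ [1+n]C[1+k]*[1+k]≡[1+n]*nCk (a + j) j ⟨
    (suc (a + j) C suc j) * suc j    ≡⟨ cong (λ l → (l C suc j) * suc j) (+-suc a j) ⟨
    ((a + suc j) C suc j) * suc j    ≡⟨ cong (_* suc j) ([m+n]Cm≡[m+n]Cn a (suc j)) ⟨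
    ((a + suc j) C a) * suc j        ≡⟨ cong (λ l → (l C a) * suc j) (+-suc a j) ⟩
    (suc (a + j) C a) * suc j        ≡⟨ *-comm _ (suc j) ⟩
    suc j * (suc (a + j) C a)        ∎

  [1+a+j]*nC[a+b]*[a+b]Ca*[n∸[a+b]]Cj≡[1+j]*nC[a+j]*[1+a+j]Ca*[n∸[a+j]]Cb : ∀ n a b j →
    suc (a + j) * (n C (a + b)) * ((a + b) C a) * ((n ∸ (a + b)) C j) ≡
    suc j * ((n C (a + j)) * (suc (a + j) C a) * ((n ∸ (a + j)) C b))
  [1+a+j]*nC[a+b]*[a+b]Ca*[n∸[a+b]]Cj≡[1+j]*nC[a+j]*[1+a+j]Ca*[n∸[a+j]]Cb n a b j = begin
    s * (n C (a + b)) * ((a + b) C a) * ((n ∸ (a + b)) C j)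
      ≡⟨ assoc³ s (n C (a + b)) _ _ ⟩
    s * ((n C (a + b)) * ((a + b) C a) * ((n ∸ (a + b)) C j))
      ≡⟨ cong (s *_) (nC[a+b]*[a+b]Ca*[n∸[a+b]]Cj≡nC[a+j]*[a+j]Ca*[n∸[a+j]]Cb n a b j) ⟩
    s * ((n C i) * (i C a) * ((n ∸ i) C b))
      ≡⟨ regroup s (n C i) (i C a) ((n ∸ i) C b) ⟩
    (n C i) * (s * (i C a)) * ((n ∸ i) C b)
      ≡⟨ cong (λ x → (n C i) * x * ((n ∸ i) C b)) ([1+a+j]*[a+j]Ca≡[1+j]*[1+a+j]Ca a j) ⟩
    (n C i) * (suc j * (s C a)) * ((n ∸ i) C b)
      ≡⟨ regroup (suc j) (n C i) (s C a) ((n ∸ i) C b) ⟨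
    suc j * ((n C i) * (s C a) * ((n ∸ i) C b)) ∎
    where
    i = a + j
    s = suc i
    assoc³ : ∀ w x y z → w * x * y * z ≡ w * (x * y * z)
    assoc³ = solve-∀
    regroup : ∀ w x y z → w * (x * y * z) ≡ x * (w * y) * z
    regroup = solve-∀

  [n∸1]C[1+k]*[1+k]*n≡nCk*[n∸k]*[n∸[1+k]] : ∀ n k →
    ((n ∸ 1) C suc k) * suc k * n ≡ (n C k) * (n ∸ k) * (n ∸ suc k)
  [n∸1]C[1+k]*[1+k]*n≡nCk*[n∸k]*[n∸[1+k]] n k = begin
    ((n ∸ 1) C suc k) * suc k * n       ≡⟨ rotate ((n ∸ 1) C suc k) (suc k) n ⟩
    n * ((n ∸ 1) C suc k) * suc k       ≡⟨ cong (_* suc k) (n*[n∸1]Ck≡nCk*[n∸k] n (suc k)) ⟩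
    (n C suc k) * (n ∸ suc k) * suc k   ≡⟨ swap (n C suc k) (n ∸ suc k) (suc k) ⟩
    (n C suc k) * suc k * (n ∸ suc k)   ≡⟨ cong (_* (n ∸ suc k)) (nC[1+k]*[1+k]≡nCk*[n∸k] n k) ⟩
    (n C k) * (n ∸ k) * (n ∸ suc k)     ∎
    where
    rotate : ∀ x y z → x * y * z ≡ z * x * y
    rotate = solve-∀
    swap : ∀ x y z → x * y * z ≡ x * z * y
    swap = solve-∀

module AlternatingSums where
  open FiniteSums
  open Binomial
  open import Data.Nat as ℕ using (ℕ; zero; suc; _∸_; _<_; _≤_; z≤n; s≤s)
  import Data.Nat.Properties as ℕₚ
  open import Data.Nat.Combinatorics using (_C_; k>n⇒nCk≡0; nCk+nC[k+1]≡[n+1]C[k+1]; nC1≡n; nCn≡1)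
  open import Data.Integer using (ℤ; +_; -_; _+_; _*_)
  import Data.Integer.Properties as ℤₚ
  open import Data.Integer.Tactic.RingSolver using (solve-∀)
  open import Data.Nat.Tactic.RingSolver renaming (solve-∀ to ℕ-solve-∀)
  open import Relation.Binary.PropositionalEquality
  open ≡-Reasoning

  sgn-+ : ∀ a b → sgn (a ℕ.+ b) ≡ sgn a * sgn b
  sgn-+ zero    b = sym (ℤₚ.*-identityˡ (sgn b))
  sgn-+ (suc a) b = trans (cong -_ (sgn-+ a b)) (ℤₚ.neg-distribˡ-* (sgn a) (sgn b))

  sgn*+[x*y]≡0 : ∀ b x {y} → y ≡ 0 → sgn b * + (x ℕ.* y) ≡ + 0
  sgn*+[x*y]≡0 b x refl = trans (cong (λ z → sgn b * + z) (ℕₚ.*-zeroʳ x)) (ℤₚ.*-zeroʳ (sgn b))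

  sgn-pascal : ∀ q d → sgn d * + (q C d) + sgn (suc d) * + (suc q C suc d) ≡ sgn (suc d) * + (q C suc d)
  sgn-pascal q d = begin
    sgn d * + (q C d) + - sgn d * + (suc q C suc d)                ≡⟨ cong (λ x → sgn d * + (q C d) + - sgn d * x) pascal ⟩
    sgn d * + (q C d) + - sgn d * (+ (q C d) + + (q C suc d))      ≡⟨ cancel (sgn d) (+ (q C d)) (+ (q C suc d)) ⟩
    - sgn d * + (q C suc d)                                        ∎
    where
    pascal : + (suc q C suc d) ≡ + (q C d) + + (q C suc d)
    pascal = trans (cong +_ (sym (nCk+nC[k+1]≡[n+1]C[k+1] q d))) (ℤₚ.pos-+ (q C d) (q C suc d))
    cancel : ∀ s x y → s * x + - s * (x + y) ≡ - s * y
    cancel = solve-∀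

  -- The coefficient of x^L in (1 - x)^p · x^j / (1 - x)^(j+1) = x^j (1 - x)^(p-j-1); hence alternatingSum-closed.
  alternatingSum : ℕ → ℕ → ℕ → ℤ
  alternatingSum p L j = sumTo (suc L) (λ b → sgn b * + ((p C b) ℕ.* ((L ∸ b) C j)))

  alternatingSum-< : ∀ p L j → L < j → alternatingSum p L j ≡ + 0
  alternatingSum-< p L j L<j =
    sumTo-zero (suc L) λ b _ → sgn*+[x*y]≡0 b (p C b) (k>n⇒nCk≡0 (ℕₚ.≤-<-trans (ℕₚ.m∸n≤m L b) L<j))

  alternatingSum-suc : ∀ p L j →
    alternatingSum p (suc L) (suc j) ≡ alternatingSum p L (suc j) + alternatingSum p L j
  alternatingSum-suc p L j = begin
    sumTo (suc L) F + F (suc L)    ≡⟨ cong (λ x → sumTo (suc L) F + x) last≡0 ⟩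
    sumTo (suc L) F + + 0          ≡⟨ ℤₚ.+-identityʳ _ ⟩
    sumTo (suc L) F                ≡⟨ sumTo-cong (suc L) (λ b b≤L → split b (ℕₚ.≤-pred b≤L)) ⟩
    sumTo (suc L) (λ b → G (suc j) b + G j b)  ≡⟨ sumTo-distrib-+ (suc L) (G (suc j)) (G j) ⟩
    alternatingSum p L (suc j) + alternatingSum p L j ∎
    where
    F : ℕ → ℤ
    F b = sgn b * + ((p C b) ℕ.* ((suc L ∸ b) C suc j))
    G : ℕ → ℕ → ℤ
    G k b = sgn b * + ((p C b) ℕ.* ((L ∸ b) C k))
    last≡0 : F (suc L) ≡ + 0
    last≡0 = sgn*+[x*y]≡0 (suc L) (p C suc L) (cong (_C suc j) (ℕₚ.n∸n≡0 L))
    split : ∀ b → b ≤ L → F b ≡ G (suc j) b + G j b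
    split b b≤L = begin
      sgn b * + ((p C b) ℕ.* ((suc L ∸ b) C suc j))
        ≡⟨ cong (λ l → sgn b * + ((p C b) ℕ.* (l C suc j))) (ℕₚ.+-∸-assoc 1 b≤L) ⟩
      sgn b * + ((p C b) ℕ.* (suc (L ∸ b) C suc j))
        ≡⟨ cong (λ x → sgn b * + ((p C b) ℕ.* x)) (nCk+nC[k+1]≡[n+1]C[k+1] (L ∸ b) j) ⟨
      sgn b * + ((p C b) ℕ.* (((L ∸ b) C j) ℕ.+ ((L ∸ b) C suc j)))
        ≡⟨ cong (λ x → sgn b * + x) (ℕₚ.*-distribˡ-+ (p C b) ((L ∸ b) C j) _) ⟩
      sgn b * + ((p C b) ℕ.* ((L ∸ b) C j) ℕ.+ (p C b) ℕ.* ((L ∸ b) C suc j))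
        ≡⟨ cong (sgn b *_) (ℤₚ.pos-+ ((p C b) ℕ.* ((L ∸ b) C j)) _) ⟩
      sgn b * (+ ((p C b) ℕ.* ((L ∸ b) C j)) + + ((p C b) ℕ.* ((L ∸ b) C suc j)))
        ≡⟨ distrib-swap (sgn b) _ _ ⟩
      G (suc j) b + G j b ∎
      where
      distrib-swap : ∀ s x y → s * (x + y) ≡ s * y + s * x
      distrib-swap = solve-∀

  alternatingSum-closed : ∀ j d q → alternatingSum (suc (j ℕ.+ q)) (j ℕ.+ d) j ≡ sgn d * + (q C d)

  private
    shifted : ∀ j d q → alternatingSum (suc (suc (j ℕ.+ q))) (j ℕ.+ d) j ≡ sgn d * + (suc q C d)
    shifted j d q = trans (cong (λ p → alternatingSum (suc p) (j ℕ.+ d) j) (sym (ℕₚ.+-suc j q)))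
                          (alternatingSum-closed j d (suc q))

  alternatingSum-closed zero    zero    q = refl
  alternatingSum-closed zero    (suc d) q = begin
    alternatingSum (suc q) d 0 + sgn (suc d) * + ((suc q C suc d) ℕ.* 1)
      ≡⟨ cong₂ (λ x y → x + sgn (suc d) * + y) (alternatingSum-closed zero d q) (ℕₚ.*-identityʳ (suc q C suc d)) ⟩
    sgn d * + (q C d) + sgn (suc d) * + (suc q C suc d)
      ≡⟨ sgn-pascal q d ⟩
    sgn (suc d) * + (q C suc d) ∎
  alternatingSum-closed (suc j) zero    q = begin
    alternatingSum p (suc (j ℕ.+ 0)) (suc j)
      ≡⟨ alternatingSum-suc p (j ℕ.+ 0) j ⟩
    alternatingSum p (j ℕ.+ 0) (suc j) + alternatingSum p (j ℕ.+ 0) j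
      ≡⟨ cong₂ _+_ (alternatingSum-< p (j ℕ.+ 0) (suc j) (s≤s (ℕₚ.≤-reflexive (ℕₚ.+-identityʳ j)))) (shifted j 0 q) ⟩
    + 0 + + 1 ∎
    where p = suc (suc (j ℕ.+ q))
  alternatingSum-closed (suc j) (suc d) q = begin
    alternatingSum p (suc (j ℕ.+ suc d)) (suc j)
      ≡⟨ alternatingSum-suc p (j ℕ.+ suc d) j ⟩
    alternatingSum p (j ℕ.+ suc d) (suc j) + alternatingSum p (j ℕ.+ suc d) j
      ≡⟨ cong₂ _+_ (trans (cong (λ L → alternatingSum p L (suc j)) (ℕₚ.+-suc j d)) (alternatingSum-closed (suc j) d q))
                   (shifted j (suc d) q) ⟩
    sgn d * + (q C d) + sgn (suc d) * + (suc q C suc d)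
      ≡⟨ sgn-pascal q d ⟩
    sgn (suc d) * + (q C suc d) ∎
    where p = suc (suc (j ℕ.+ q))

  private
    [2+L]∸b∸2≡L∸b : ∀ L b → suc (suc L) ∸ b ∸ 2 ≡ L ∸ b
    [2+L]∸b∸2≡L∸b L b = trans (ℕₚ.∸-+-assoc (suc (suc L)) b 2)
                              (trans (cong (suc (suc L) ∸_) (ℕₚ.+-comm b 2)) (ℕₚ.[m+n]∸[m+o]≡n∸o 2 L b))

  alternatingSum-padded : ∀ j d →
    sumTo (suc (j ℕ.+ d) ℕ.+ j) (λ b → sgn b * + ((suc (suc (j ℕ.+ d)) C b) ℕ.* ((suc (suc (j ℕ.+ d)) ∸ b ∸ 2) C j)))
      ≡ sgn d * + suc d
  alternatingSum-padded j d = begin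
    sumTo (suc L ℕ.+ j) F                          ≡⟨ sumTo-split (suc L) j F ⟩
    sumTo (suc L) F + sumTo j (λ t → F (suc L ℕ.+ t))
      ≡⟨ cong₂ _+_ (sumTo-cong (suc L) λ b _ → cong (λ l → sgn b * + ((suc (suc L) C b) ℕ.* (l C j)))
                                                    ([2+L]∸b∸2≡L∸b L b))
                   (sumTo-zero j tail≡0) ⟩
    alternatingSum (suc (suc L)) L j + + 0        ≡⟨ ℤₚ.+-identityʳ _ ⟩
    alternatingSum (suc (suc L)) L j              ≡⟨ cong (λ p → alternatingSum (suc p) L j) (ℕₚ.+-suc j d) ⟨
    alternatingSum (suc (j ℕ.+ suc d)) L j        ≡⟨ alternatingSum-closed j d (suc d) ⟩
    sgn d * + (suc d C d)                         ≡⟨ cong (λ x → sgn d * + x) ([1+n]Cn≡1+n d) ⟩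
    sgn d * + suc d                               ∎
    where
    L = j ℕ.+ d
    F : ℕ → ℤ
    F b = sgn b * + ((suc (suc L) C b) ℕ.* ((suc (suc L) ∸ b ∸ 2) C j))
    tail≡0 : ∀ t → t < j → F (suc L ℕ.+ t) ≡ + 0
    tail≡0 t t<j = sgn*+[x*y]≡0 b (suc (suc L) C b)
      (trans (cong (_C j) (trans ([2+L]∸b∸2≡L∸b L b) (ℕₚ.m≤n⇒m∸n≡0 L≤b))) (k>n⇒nCk≡0 (ℕₚ.≤-<-trans z≤n t<j)))
      where
      b = suc L ℕ.+ t
      L≤b : L ≤ b
      L≤b = ℕₚ.≤-trans (ℕₚ.n≤1+n L) (ℕₚ.m≤m+n (suc L) t)

  weightedAlternatingSum : ℕ → ℕ → ℤ
  weightedAlternatingSum i e = sumTo (suc i) (λ a → sgn a * + ((suc i C a) ℕ.* suc (a ℕ.+ e)))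

  -- Split the weight a + e + 1 as (i + e + 1) - C(i - a, 1).
  weightedAlternatingSum≡ : ∀ i e →
    weightedAlternatingSum i e ≡ + suc (i ℕ.+ e) * alternatingSum (suc i) i 0 + - alternatingSum (suc i) i 1
  weightedAlternatingSum≡ i e = begin
    weightedAlternatingSum i e
      ≡⟨ sumTo-cong (suc i) (λ a a≤i → split a (ℕₚ.≤-pred a≤i)) ⟩
    sumTo (suc i) (λ a → + suc (i ℕ.+ e) * F 0 a + - F 1 a)
      ≡⟨ sumTo-distrib-+ (suc i) _ _ ⟩
    sumTo (suc i) (λ a → + suc (i ℕ.+ e) * F 0 a) + sumTo (suc i) (λ a → - F 1 a)
      ≡⟨ cong₂ _+_ (*-distribˡ-sumTo (suc i) (+ suc (i ℕ.+ e)) (F 0)) (neg-distrib-sumTo (suc i) (F 1)) ⟨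
    + suc (i ℕ.+ e) * alternatingSum (suc i) i 0 + - alternatingSum (suc i) i 1 ∎
    where
    F : ℕ → ℕ → ℤ
    F j a = sgn a * + ((suc i C a) ℕ.* ((i ∸ a) C j))
    split : ∀ a → a ≤ i → sgn a * + ((suc i C a) ℕ.* suc (a ℕ.+ e)) ≡ + suc (i ℕ.+ e) * F 0 a + - F 1 a
    split a a≤i = begin
      sgn a * + ((suc i C a) ℕ.* suc (a ℕ.+ e))
        ≡⟨ cong (sgn a *_) (ℤₚ.pos-* (suc i C a) _) ⟩
      sgn a * (x * + suc (a ℕ.+ e))
        ≡⟨ rearrange (sgn a) x (+ suc (a ℕ.+ e)) (+ (i ∸ a)) ⟩
      (+ suc (a ℕ.+ e) + + (i ∸ a)) * (sgn a * (x * + 1)) + - (sgn a * (x * + (i ∸ a)))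
        ≡⟨ cong₂ (λ w y → w * (sgn a * (x * + 1)) + - (sgn a * y)) weight (sym (ℤₚ.pos-* (suc i C a) (i ∸ a))) ⟩
      + suc (i ℕ.+ e) * (sgn a * (x * + 1)) + - (sgn a * + ((suc i C a) ℕ.* (i ∸ a)))
        ≡⟨ cong₂ (λ y z → + suc (i ℕ.+ e) * (sgn a * y) + - (sgn a * + ((suc i C a) ℕ.* z)))
                 (sym (ℤₚ.pos-* (suc i C a) 1)) (sym (nC1≡n (i ∸ a))) ⟩
      + suc (i ℕ.+ e) * F 0 a + - F 1 a ∎
      where
      x = + (suc i C a)
      +-right-comm : ∀ a e k → a ℕ.+ e ℕ.+ k ≡ a ℕ.+ k ℕ.+ e
      +-right-comm = ℕ-solve-∀
      weight : + suc (a ℕ.+ e) + + (i ∸ a) ≡ + suc (i ℕ.+ e)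
      weight = trans (sym (ℤₚ.pos-+ (suc (a ℕ.+ e)) (i ∸ a)))
                     (cong (λ l → + suc l) (trans (+-right-comm a e (i ∸ a)) (cong (ℕ._+ e) (ℕₚ.m+[n∸m]≡n a≤i))))
      rearrange : ∀ s x w v → s * (x * w) ≡ (w + v) * (s * (x * + 1)) + - (s * (x * v))
      rearrange = solve-∀

  weightedAlternatingSum-zero : ∀ e → weightedAlternatingSum 0 e ≡ + suc e
  weightedAlternatingSum-zero e = begin
    weightedAlternatingSum 0 e                                  ≡⟨ weightedAlternatingSum≡ 0 e ⟩
    + suc e * alternatingSum 1 0 0 + - alternatingSum 1 0 1    ≡⟨ cong (λ x → + suc e * + 1 + - x) (alternatingSum-< 1 0 1 (s≤s z≤n)) ⟩
    + suc e * + 1 + - + 0                                       ≡⟨ simplify (+ suc e) ⟩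
    + suc e                                                     ∎
    where
    simplify : ∀ w → w * + 1 + - + 0 ≡ w
    simplify = solve-∀

  weightedAlternatingSum-suc : ∀ i e → weightedAlternatingSum (suc i) e ≡ sgn (suc i) * + suc (suc (suc i ℕ.+ e))
  weightedAlternatingSum-suc i e = begin
    weightedAlternatingSum (suc i) e
      ≡⟨ weightedAlternatingSum≡ (suc i) e ⟩
    w * alternatingSum (suc (suc i)) (suc i) 0 + - alternatingSum (suc (suc i)) (suc i) 1
      ≡⟨ cong₂ (λ x y → w * x + - y) (alternatingSum-closed 0 (suc i) (suc i)) (alternatingSum-closed 1 i i) ⟩
    w * (sgn (suc i) * + (suc i C suc i)) + - (sgn i * + (i C i))
      ≡⟨ cong₂ (λ x y → w * (sgn (suc i) * + x) + - (sgn i * + y)) (nCn≡1 (suc i)) (nCn≡1 i) ⟩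
    w * (- sgn i * + 1) + - (sgn i * + 1)
      ≡⟨ simplify (sgn i) w ⟩
    - sgn i * (+ 1 + w)
      ≡⟨ cong (- sgn i *_) (ℤₚ.pos-+ 1 (suc (suc i ℕ.+ e))) ⟨
    sgn (suc i) * + suc (suc (suc i ℕ.+ e)) ∎
    where
    w = + suc (suc i ℕ.+ e)
    simplify : ∀ s w → w * (- s * + 1) + - (s * + 1) ≡ - s * (+ 1 + w)
    simplify = solve-∀

module CharacteristicPolynomial where
  open FiniteSums
  open Binomial using ([1+n]Cn≡1+n)
  open import Data.Nat as ℕ using (ℕ; suc; _∸_; _⊓_; _<_; _≤_; s≤s)
  import Data.Nat.Properties as ℕₚ
  open import Data.Nat.Combinatorics using (_C_; nCn≡1)
  open import Data.Integer using (ℤ; +_; -_; _+_; _*_)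
  import Data.Integer.Properties as ℤₚ
  open import Data.Integer.Tactic.RingSolver using (solve-∀)
  open import Relation.Binary.PropositionalEquality
  open import Relation.Nullary using (yes; no; contradiction)
  open ≡-Reasoning

  δ-refl : ∀ a → δ a a ≡ + 1
  δ-refl a with a ℕ.≟ a
  ... | yes _   = refl
  ... | no  a≢a = contradiction refl a≢a

  δ-≢ : ∀ {a b} → a ≢ b → δ a b ≡ + 0
  δ-≢ {a} {b} a≢b with a ℕ.≟ b
  ... | yes a≡b = contradiction a≡b a≢b
  ... | no  _   = refl

  private
    term≡0 : ∀ s x {y} → y ≡ + 0 → s * x * y ≡ + 0
    term≡0 s x refl = ℤₚ.*-zeroʳ (s * x)

  χU-pos : ∀ r m i → 1 ≤ i → i ≤ r → r ≤ m → χU r m i ≡ sgn (r ∸ i) * + (m C (r ∸ i))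
  χU-pos r m i 1≤i i≤r r≤m = trans (sumTo-single (suc m) p p<1+m others) fp
    where
    p = r ∸ i
    f : ℕ → ℤ
    f k = sgn k * + (m C k) * δ (r ∸ (k ⊓ r)) i
    p≤r : p ≤ r
    p≤r = ℕₚ.m∸n≤m r i
    p<1+m : p < suc m
    p<1+m = s≤s (ℕₚ.≤-trans p≤r r≤m)
    fp : f p ≡ sgn p * + (m C p)
    fp = begin
      sgn p * + (m C p) * δ (r ∸ (p ⊓ r)) i ≡⟨ cong (λ l → sgn p * + (m C p) * δ (r ∸ l) i) (ℕₚ.m≤n⇒m⊓n≡m p≤r) ⟩
      sgn p * + (m C p) * δ (r ∸ p) i       ≡⟨ cong (λ l → sgn p * + (m C p) * δ l i) (ℕₚ.m∸[m∸n]≡n i≤r) ⟩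
      sgn p * + (m C p) * δ i i             ≡⟨ cong (sgn p * + (m C p) *_) (δ-refl i) ⟩
      sgn p * + (m C p) * + 1               ≡⟨ ℤₚ.*-identityʳ _ ⟩
      sgn p * + (m C p)                     ∎
    others : ∀ k → k < suc m → k ≢ p → f k ≡ + 0
    others k _ k≢p with k ℕ.≤? r
    ... | yes k≤r = term≡0 (sgn k) (+ (m C k)) (trans (cong (λ l → δ (r ∸ l) i) (ℕₚ.m≤n⇒m⊓n≡m k≤r)) (δ-≢ r∸k≢i))
      where
      r∸k≢i : r ∸ k ≢ i
      r∸k≢i r∸k≡i = k≢p (trans (sym (ℕₚ.m∸[m∸n]≡n k≤r)) (cong (r ∸_) r∸k≡i))
    ... | no  k≰r = term≡0 (sgn k) (+ (m C k))
      (trans (cong (λ l → δ (r ∸ l) i) (ℕₚ.m≥n⇒m⊓n≡n (ℕₚ.<⇒≤ (ℕₚ.≰⇒> k≰r))))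
             (trans (cong (λ l → δ l i) (ℕₚ.n∸n≡0 r)) (δ-≢ (λ 0≡i → ℕₚ.<⇒≢ 1≤i 0≡i))))

  χU-zero : ∀ r → χU r (suc r) 0 ≡ sgn r * + r
  χU-zero r = begin
    sumTo r f + f r + f (suc r)                                      ≡⟨ cong₂ (λ x y → x + y + f (suc r)) (sumTo-zero r below) top ⟩
    + 0 + sgn r * + suc r + f (suc r)                                ≡⟨ cong (λ x → + 0 + sgn r * + suc r + x) top+1 ⟩
    + 0 + sgn r * + suc r + - sgn r * + 1                            ≡⟨ cong (λ x → + 0 + sgn r * x + - sgn r * + 1) (ℤₚ.pos-+ 1 r) ⟩
    + 0 + sgn r * (+ 1 + + r) + - sgn r * + 1                        ≡⟨ simplify (sgn r) (+ r) ⟩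
    sgn r * + r                                                      ∎
    where
    f : ℕ → ℤ
    f k = sgn k * + (suc r C k) * δ (r ∸ (k ⊓ r)) 0
    below : ∀ k → k < r → f k ≡ + 0
    below k k<r = term≡0 (sgn k) (+ (suc r C k))
      (trans (cong (λ l → δ (r ∸ l) 0) (ℕₚ.m≤n⇒m⊓n≡m (ℕₚ.<⇒≤ k<r))) (δ-≢ (ℕₚ.m>n⇒m∸n≢0 k<r)))
    top : f r ≡ sgn r * + suc r
    top = begin
      sgn r * + (suc r C r) * δ (r ∸ (r ⊓ r)) 0  ≡⟨ cong₂ (λ x l → sgn r * + x * δ (r ∸ l) 0) ([1+n]Cn≡1+n r) (ℕₚ.⊓-idem r) ⟩
      sgn r * + suc r * δ (r ∸ r) 0              ≡⟨ cong (λ l → sgn r * + suc r * δ l 0) (ℕₚ.n∸n≡0 r) ⟩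
      sgn r * + suc r * + 1                      ≡⟨ ℤₚ.*-identityʳ _ ⟩
      sgn r * + suc r                            ∎
    top+1 : f (suc r) ≡ - sgn r * + 1
    top+1 = begin
      - sgn r * + (suc r C suc r) * δ (r ∸ (suc r ⊓ r)) 0  ≡⟨ cong₂ (λ x l → - sgn r * + x * δ (r ∸ l) 0)
                                                                     (nCn≡1 (suc r)) (ℕₚ.m≥n⇒m⊓n≡n (ℕₚ.n≤1+n r)) ⟩
      - sgn r * + 1 * δ (r ∸ r) 0                          ≡⟨ cong (λ l → - sgn r * + 1 * δ l 0) (ℕₚ.n∸n≡0 r) ⟩
      - sgn r * + 1 * + 1                                  ≡⟨ ℤₚ.*-identityʳ _ ⟩
      - sgn r * + 1                                        ∎
    simplify : ∀ s x → + 0 + s * (+ 1 + x) + - s * + 1 ≡ s * x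
    simplify = solve-∀

module KazhdanLusztigRecursion where
  open FiniteSums
  open import Data.Nat as ℕ using (ℕ; zero; suc; _∸_; _≤_; _≤?_; z≤n)
  import Data.Nat.Properties as ℕₚ
  open import Data.Nat.Combinatorics using (_C_)
  open import Data.Integer using (ℤ; +_; -_; _+_; _*_)
  import Data.Integer.Properties as ℤₚ
  open import Data.Sum using (inj₁; inj₂)
  open import Relation.Binary.PropositionalEquality
  open import Relation.Nullary using (yes; no; ¬_; contradiction)

  KLall-suc : ∀ R s m i → s ≤ R → KLall (suc R) s m i ≡ KLall R s m i
  KLall-suc R s m i s≤R with s ≤? R
  ... | yes _   = refl
  ... | no  s≰R = contradiction s≤R s≰R

  KLall-stable : ∀ R s m i → s ≤ R → KLall R s m i ≡ KLU s m i
  KLall-stable zero    .zero m i z≤n = refl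
  KLall-stable (suc R) s     m i s≤1+R with ℕₚ.m≤n⇒m<n∨m≡n s≤1+R
  ... | inj₁ s<1+R = trans (KLall-suc R s m i (ℕₚ.≤-pred s<1+R)) (KLall-stable R s m i (ℕₚ.≤-pred s<1+R))
  ... | inj₂ refl  = refl

  KLU-suc-recursion : ∀ R m i → suc (i ℕ.+ i) ≤ suc R → KLU (suc R) m i ≡ - rhs (KLall R) (suc R) m i
  KLU-suc-recursion R m i low with suc R ≤? R
  ... | yes 1+R≤R = contradiction 1+R≤R (ℕₚ.n≮n R)
  ... | no  _ with suc (i ℕ.+ i) ≤? suc R
  ...   | yes _    = refl
  ...   | no  high = contradiction low high

  KLU-suc-vanishing : ∀ R m i → ¬ suc (i ℕ.+ i) ≤ suc R → KLU (suc R) m i ≡ + 0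
  KLU-suc-vanishing R m i high with suc R ≤? R
  ... | yes 1+R≤R = contradiction 1+R≤R (ℕₚ.n≮n R)
  ... | no  _ with suc (i ℕ.+ i) ≤? suc R
  ...   | yes low = contradiction low high
  ...   | no  _   = refl

  -- The nonempty proper flats in rhs for M = U_{n-1,n}, n = R + 2: the flat of size k + 1 has contraction
  -- U_{R-k,R+1-k}, whose coefficients are again given by c.
  flatSum : ℕ → ℕ → ℤ
  flatSum R i = sumTo R λ k → + (suc (suc R) C suc k) * sumTo (suc i) λ a → tm1 (suc k) a * c (suc R ∸ k) (i ∸ a)

  c-recursion : ∀ R i → suc (i ℕ.+ i) ≤ suc R → c (suc (suc R)) i ≡ - (flatSum R i + χU (suc R) (suc (suc R)) i)
  c-recursion R i low = trans (KLU-suc-recursion R (suc (suc R)) i low) (cong -_ flats)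
    where
    R∸k≡1+R∸k∸1 : ∀ k → R ∸ k ≡ suc R ∸ k ∸ 1
    R∸k≡1+R∸k∸1 k = sym (trans (ℕₚ.∸-+-assoc (suc R) k 1) (cong (suc R ∸_) (ℕₚ.+-comm k 1)))
    contraction : ∀ k j → KLall R (R ∸ k) (suc R ∸ k) j ≡ c (suc R ∸ k) j
    contraction k j = trans (KLall-stable R (R ∸ k) (suc R ∸ k) j (ℕₚ.m∸n≤m R k))
                            (cong (λ r → KLU r (suc R ∸ k) j) (R∸k≡1+R∸k∸1 k))
    flats : rhs (KLall R) (suc R) (suc (suc R)) i ≡ flatSum R i + χU (suc R) (suc (suc R)) i
    flats = cong (_+ χU (suc R) (suc (suc R)) i) (trans (sumTo-head R _) (trans (ℤₚ.+-identityˡ _)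
              (sumTo-cong R λ k _ → cong (+ (suc (suc R) C suc k) *_)
                (sumTo-cong (suc i) λ a _ → cong (tm1 (suc k) a *_) (contraction k (i ∸ a))))))

  c-vanishing : ∀ R i → ¬ suc (i ℕ.+ i) ≤ suc R → c (suc (suc R)) i ≡ + 0
  c-vanishing R i = KLU-suc-vanishing R (suc (suc R)) i

module ClosedForm where
  open FiniteSums
  open Binomial
  open AlternatingSums
  open CharacteristicPolynomial
  open KazhdanLusztigRecursion
  open import Data.Nat as ℕ using (ℕ; zero; suc; _∸_; _<_; _≤_; z≤n; s≤s)
  import Data.Nat.Properties as ℕₚ
  open import Data.Nat.Combinatorics using (_C_; k>n⇒nCk≡0)
  open import Data.Nat.Tactic.RingSolver renaming (solve-∀ to ℕ-solve-∀)
  open import Data.Integer using (ℤ; +_; -_; _+_; _*_; _-_)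
  import Data.Integer.Properties as ℤₚ
  open import Data.Integer.Tactic.RingSolver using (solve-∀)
  open import Relation.Binary.PropositionalEquality
  open import Relation.Nullary using (yes; no; ¬_; contradiction)
  open import Data.Nat.Induction using (<-rec)
  open ≡-Reasoning

  ClosedFormAt : ℕ → Set
  ClosedFormAt n = ∀ j → + suc j * c n j ≡ + ((n C j) ℕ.* ((n ∸ j ∸ 2) C j))

  flatTerm : ℕ → ℕ → ℕ → ℕ → ℤ
  flatTerm n i k a = + suc i * (+ (n C k) * (tm1 k a * c (n ∸ k) (i ∸ a)))

  reindexedTerm : ℕ → ℕ → ℕ → ℕ → ℤ
  reindexedTerm n i a b =
    sgn b * + ((n C i) ℕ.* (suc i C a) ℕ.* ((n ∸ i) C b) ℕ.* ((n ∸ i ∸ b ∸ 2) C (i ∸ a)))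

  private
    pos-*⁴ : ∀ w x y z → + w * + x * + y * + z ≡ + (w ℕ.* x ℕ.* y ℕ.* z)
    pos-*⁴ w x y z = sym (trans (ℤₚ.pos-* (w ℕ.* x ℕ.* y) z)
                                (cong (_* + z) (trans (ℤₚ.pos-* (w ℕ.* x) y) (cong (_* + y) (ℤₚ.pos-* w x)))))

  -- The closed form only determines (j + 1) c_{m,j}, hence the cancellation of j + 1.
  flatTerm≡reindexedTerm′ : ∀ n a b j → ClosedFormAt (n ∸ (a ℕ.+ b)) →
                            flatTerm n (a ℕ.+ j) (a ℕ.+ b) a ≡ reindexedTerm n (a ℕ.+ j) a b
  flatTerm≡reindexedTerm′ n a b j closed = ℤₚ.*-cancelˡ-≡ (+ suc j) _ _ (begin
    + suc j * (+ s * (+ A * (sgn (a ℕ.+ b ∸ a) * + B * c m (i ∸ a))))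
      ≡⟨ cong₂ (λ u v → + suc j * (+ s * (+ A * (sgn u * + B * c m v)))) (ℕₚ.m+n∸m≡n a b) i∸a≡j ⟩
    + suc j * (+ s * (+ A * (sgn b * + B * c m j)))
      ≡⟨ regroup (+ suc j) (+ s) (+ A) (sgn b) (+ B) (c m j) ⟩
    sgn b * (+ s * + A * + B * (+ suc j * c m j))
      ≡⟨ cong (λ x → sgn b * (+ s * + A * + B * x)) (closed j) ⟩
    sgn b * (+ s * + A * + B * + ((m C j) ℕ.* W))
      ≡⟨ cong (sgn b *_) (pos-*⁴ s A B _) ⟩
    sgn b * + (s ℕ.* A ℕ.* B ℕ.* ((m C j) ℕ.* W))
      ≡⟨ cong (λ x → sgn b * + x) natural ⟩
    sgn b * + (suc j ℕ.* (K ℕ.* W′))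
      ≡⟨ cong (sgn b *_) (ℤₚ.pos-* (suc j) _) ⟩
    sgn b * (+ suc j * + (K ℕ.* W′))
      ≡⟨ swap (sgn b) (+ suc j) _ ⟩
    + suc j * (sgn b * + (K ℕ.* W′))
      ≡⟨ cong (λ v → + suc j * (sgn b * + (K ℕ.* ((n ∸ i ∸ b ∸ 2) C v)))) i∸a≡j ⟨
    + suc j * reindexedTerm n i a b ∎)
    where
    +-right-comm : ∀ x y z → x ℕ.+ y ℕ.+ z ≡ x ℕ.+ z ℕ.+ y
    +-right-comm = ℕ-solve-∀
    regroup : ∀ t u v σ w γ → t * (u * (v * (σ * w * γ))) ≡ σ * (u * v * w * (t * γ))
    regroup = solve-∀
    swap : ∀ σ t x → σ * (t * x) ≡ t * (σ * x)
    swap = solve-∀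
    i = a ℕ.+ j
    s = suc i
    m = n ∸ (a ℕ.+ b)
    A = n C (a ℕ.+ b)
    B = (a ℕ.+ b) C a
    K = (n C i) ℕ.* (s C a) ℕ.* ((n ∸ i) C b)
    W = (m ∸ j ∸ 2) C j
    W′ = (n ∸ i ∸ b ∸ 2) C j
    i∸a≡j : i ∸ a ≡ j
    i∸a≡j = ℕₚ.m+n∸m≡n a j
    m∸j≡n∸i∸b : m ∸ j ≡ n ∸ i ∸ b
    m∸j≡n∸i∸b = begin
      n ∸ (a ℕ.+ b) ∸ j   ≡⟨ ℕₚ.∸-+-assoc n (a ℕ.+ b) j ⟩
      n ∸ (a ℕ.+ b ℕ.+ j) ≡⟨ cong (n ∸_) (+-right-comm a b j) ⟩
      n ∸ (i ℕ.+ b)       ≡⟨ ℕₚ.∸-+-assoc n i b ⟨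
      n ∸ i ∸ b           ∎
    natural : s ℕ.* A ℕ.* B ℕ.* ((m C j) ℕ.* W) ≡ suc j ℕ.* (K ℕ.* W′)
    natural = begin
      s ℕ.* A ℕ.* B ℕ.* ((m C j) ℕ.* W)
        ≡⟨ ℕₚ.*-assoc (s ℕ.* A ℕ.* B) (m C j) W ⟨
      s ℕ.* A ℕ.* B ℕ.* (m C j) ℕ.* W
        ≡⟨ cong (ℕ._* W) ([1+a+j]*nC[a+b]*[a+b]Ca*[n∸[a+b]]Cj≡[1+j]*nC[a+j]*[1+a+j]Ca*[n∸[a+j]]Cb n a b j) ⟩
      suc j ℕ.* K ℕ.* W
        ≡⟨ ℕₚ.*-assoc (suc j) K W ⟩
      suc j ℕ.* (K ℕ.* W)
        ≡⟨ cong (λ l → suc j ℕ.* (K ℕ.* ((l ∸ 2) C j))) m∸j≡n∸i∸b ⟩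
      suc j ℕ.* (K ℕ.* W′) ∎

  flatTerm≡reindexedTerm : ∀ n i a b → a ≤ i → ClosedFormAt (n ∸ (a ℕ.+ b)) →
                           flatTerm n i (a ℕ.+ b) a ≡ reindexedTerm n i a b
  flatTerm≡reindexedTerm n i a b a≤i closed = subst (λ l → flatTerm n l (a ℕ.+ b) a ≡ reindexedTerm n l a b)
                                                    (ℕₚ.m+[n∸m]≡n a≤i) (flatTerm≡reindexedTerm′ n a b (i ∸ a) closed)

  reindexedSum : ℕ → ℕ → ℤ
  reindexedSum R i = sumTo (suc i) (λ a → sumTo (suc R ∸ a) (reindexedTerm (suc (suc R)) i a))

  -- Substitute k = a + b: the terms with k < a vanish, and the closed form of (i + 1) c_{n,i} fills in k = 0.
  flatSum≡reindexedSum : ∀ R i → (∀ {m} → m < suc (suc R) → ClosedFormAt m) → i ≤ R →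
    + suc i * flatSum R i + + ((suc (suc R) C i) ℕ.* ((suc (suc R) ∸ i ∸ 2) C i)) ≡ reindexedSum R i
  flatSum≡reindexedSum R i closed i≤R = begin
    + suc i * flatSum R i + X
      ≡⟨ cong (_+ X) scale ⟩
    sumTo R (λ k → sumTo (suc i) (T (suc k))) + X
      ≡⟨ cong (_+ X) (trans (sumTo-comm R (suc i) (λ k → T (suc k))) (sumTo-head i _)) ⟩
    sumTo R (λ k → T (suc k) 0) + sumTo i (λ a → sumTo R (λ k → T (suc k) (suc a))) + X
      ≡⟨ cong₂ (λ x y → x + y + X) (sumTo-cong R λ k _ → flatTerm≡reindexedTerm n i 0 (suc k) z≤n (closed (contraction< k)))
                                   (sumTo-cong i λ a a<i → shift a a<i) ⟩
    sumTo R (λ b → Rt 0 (suc b)) + Y + X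
      ≡⟨ rotate (sumTo R (λ b → Rt 0 (suc b))) Y X ⟩
    X + sumTo R (λ b → Rt 0 (suc b)) + Y
      ≡⟨ cong (λ x → x + sumTo R (λ b → Rt 0 (suc b)) + Y) corner ⟩
    Rt 0 0 + sumTo R (λ b → Rt 0 (suc b)) + Y
      ≡⟨ trans (sumTo-head i (λ a → sumTo (suc R ∸ a) (Rt a))) (cong (_+ Y) (sumTo-head R (Rt 0))) ⟨
    reindexedSum R i ∎
    where
    n = suc (suc R)
    X = + ((n C i) ℕ.* ((n ∸ i ∸ 2) C i))
    T = flatTerm n i
    Rt = reindexedTerm n i
    Y = sumTo i (λ a → sumTo (R ∸ a) (Rt (suc a)))
    rotate : ∀ x y z → x + y + z ≡ z + x + y
    rotate = solve-∀
    contraction< : ∀ k → suc R ∸ k < n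
    contraction< k = s≤s (ℕₚ.m∸n≤m (suc R) k)
    scale : + suc i * flatSum R i ≡ sumTo R (λ k → sumTo (suc i) (T (suc k)))
    scale = trans (*-distribˡ-sumTo R (+ suc i) _) (sumTo-cong R λ k _ →
              trans (cong (+ suc i *_) (*-distribˡ-sumTo (suc i) (+ (n C suc k)) _))
                    (*-distribˡ-sumTo (suc i) (+ suc i) _))
    corner : X ≡ Rt 0 0
    corner = sym (trans (ℤₚ.*-identityˡ _) (cong (λ x → + (x ℕ.* ((n ∸ i ∸ 2) C i)))
                                                 (trans (ℕₚ.*-identityʳ ((n C i) ℕ.* 1)) (ℕₚ.*-identityʳ (n C i)))))
    shift : ∀ a → a < i → sumTo R (λ k → T (suc k) (suc a)) ≡ sumTo (R ∸ a) (Rt (suc a))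
    shift a a<i = begin
      sumTo R (λ k → T (suc k) (suc a))
        ≡⟨ cong (λ l → sumTo l (λ k → T (suc k) (suc a))) (ℕₚ.m+[n∸m]≡n a≤R) ⟨
      sumTo (a ℕ.+ (R ∸ a)) (λ k → T (suc k) (suc a))
        ≡⟨ sumTo-split a (R ∸ a) _ ⟩
      sumTo a (λ k → T (suc k) (suc a)) + sumTo (R ∸ a) (λ b → T (suc (a ℕ.+ b)) (suc a))
        ≡⟨ cong₂ _+_ (sumTo-zero a below) (sumTo-cong (R ∸ a) λ b _ →
             flatTerm≡reindexedTerm n i (suc a) b a<i (closed (contraction< (a ℕ.+ b)))) ⟩
      + 0 + sumTo (R ∸ a) (Rt (suc a))
        ≡⟨ ℤₚ.+-identityˡ _ ⟩
      sumTo (R ∸ a) (Rt (suc a)) ∎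
      where
      a≤R : a ≤ R
      a≤R = ℕₚ.≤-trans (ℕₚ.<⇒≤ a<i) i≤R
      below : ∀ k → k < a → T (suc k) (suc a) ≡ + 0
      below k k<a = trans (cong (λ x → + suc i * (+ (n C suc k) * (sgn (k ∸ a) * + x * y))) (k>n⇒nCk≡0 (s≤s k<a)))
                          (vanish (+ suc i) (+ (n C suc k)) (sgn (k ∸ a)) y)
        where
        y = c (n ∸ suc k) (i ∸ suc a)
        vanish : ∀ t x σ y → t * (x * (σ * + 0 * y)) ≡ + 0
        vanish = solve-∀

  private
    m≡n+o⇒m∸n≡o : ∀ {m} n {o} → m ≡ n ℕ.+ o → m ∸ n ≡ o
    m≡n+o⇒m∸n≡o n {o} refl = ℕₚ.m+n∸m≡n n o

  reindexedInnerSum′ : ∀ a j e → let i = a ℕ.+ j; n = suc (suc (i ℕ.+ i ℕ.+ e)) in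
    sumTo (suc (i ℕ.+ i ℕ.+ e) ∸ a) (reindexedTerm n i a)
      ≡ + ((n C i) ℕ.* (suc i C a)) * (sgn (a ℕ.+ e) * + suc (a ℕ.+ e))
  reindexedInnerSum′ a j e = begin
    sumTo (suc R ∸ a) (reindexedTerm n i a)
      ≡⟨ sumTo-cong (suc R ∸ a) (λ b _ → factor b) ⟩
    sumTo (suc R ∸ a) (λ b → + P * F (n ∸ i) (i ∸ a) b)
      ≡⟨ *-distribˡ-sumTo (suc R ∸ a) (+ P) _ ⟨
    + P * sumTo (suc R ∸ a) (F (n ∸ i) (i ∸ a))
      ≡⟨ cong₂ (λ u N → + P * sumTo u (F N (i ∸ a))) (m≡n+o⇒m∸n≡o a (bound a j e))
                                                      (m≡n+o⇒m∸n≡o i (size a j e)) ⟩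
    + P * sumTo (suc (j ℕ.+ d) ℕ.+ j) (F (suc (suc (j ℕ.+ d))) (i ∸ a))
      ≡⟨ cong (λ v → + P * sumTo (suc (j ℕ.+ d) ℕ.+ j) (F (suc (suc (j ℕ.+ d))) v)) (ℕₚ.m+n∸m≡n a j) ⟩
    + P * sumTo (suc (j ℕ.+ d) ℕ.+ j) (F (suc (suc (j ℕ.+ d))) j)
      ≡⟨ cong (+ P *_) (alternatingSum-padded j d) ⟩
    + P * (sgn d * + suc d) ∎
    where
    i = a ℕ.+ j
    R = i ℕ.+ i ℕ.+ e
    n = suc (suc R)
    d = a ℕ.+ e
    P = (n C i) ℕ.* (suc i C a)
    F : ℕ → ℕ → ℕ → ℤ
    F N v b = sgn b * + ((N C b) ℕ.* ((N ∸ b ∸ 2) C v))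
    bound : ∀ a j e → suc (a ℕ.+ j ℕ.+ (a ℕ.+ j) ℕ.+ e) ≡ a ℕ.+ (suc (j ℕ.+ (a ℕ.+ e)) ℕ.+ j)
    bound = ℕ-solve-∀
    size : ∀ a j e → suc (suc (a ℕ.+ j ℕ.+ (a ℕ.+ j) ℕ.+ e)) ≡ a ℕ.+ j ℕ.+ suc (suc (j ℕ.+ (a ℕ.+ e)))
    size = ℕ-solve-∀
    regroup : ∀ σ p q → σ * (p * q) ≡ p * (σ * q)
    regroup = solve-∀
    factor : ∀ b → reindexedTerm n i a b ≡ + P * F (n ∸ i) (i ∸ a) b
    factor b = begin
      sgn b * + (P ℕ.* ((n ∸ i) C b) ℕ.* W)     ≡⟨ cong (λ x → sgn b * + x) (ℕₚ.*-assoc P ((n ∸ i) C b) W) ⟩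
      sgn b * + (P ℕ.* (((n ∸ i) C b) ℕ.* W))   ≡⟨ cong (sgn b *_) (ℤₚ.pos-* P _) ⟩
      sgn b * (+ P * + (((n ∸ i) C b) ℕ.* W))   ≡⟨ regroup (sgn b) (+ P) _ ⟩
      + P * F (n ∸ i) (i ∸ a) b                 ∎
      where W = (n ∸ i ∸ b ∸ 2) C (i ∸ a)

  reindexedInnerSum : ∀ i e a → a ≤ i → let n = suc (suc (i ℕ.+ i ℕ.+ e)) in
    sumTo (suc (i ℕ.+ i ℕ.+ e) ∸ a) (reindexedTerm n i a)
      ≡ + ((n C i) ℕ.* (suc i C a)) * (sgn (a ℕ.+ e) * + suc (a ℕ.+ e))
  reindexedInnerSum i e a a≤i =
    subst (λ l → sumTo (suc (l ℕ.+ l ℕ.+ e) ∸ a) (reindexedTerm (suc (suc (l ℕ.+ l ℕ.+ e))) l a)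
                   ≡ + ((suc (suc (l ℕ.+ l ℕ.+ e)) C l) ℕ.* (suc l C a)) * (sgn (a ℕ.+ e) * + suc (a ℕ.+ e)))
          (ℕₚ.m+[n∸m]≡n a≤i) (reindexedInnerSum′ a (i ∸ a) e)

  reindexedSum≡ : ∀ i e → let n = suc (suc (i ℕ.+ i ℕ.+ e)) in
    reindexedSum (i ℕ.+ i ℕ.+ e) i ≡ + (n C i) * sgn e * weightedAlternatingSum i e
  reindexedSum≡ i e = begin
    reindexedSum (i ℕ.+ i ℕ.+ e) i
      ≡⟨ sumTo-cong (suc i) (λ a a≤i → trans (reindexedInnerSum i e a (ℕₚ.≤-pred a≤i)) (regroup a)) ⟩
    sumTo (suc i) (λ a → + (n C i) * sgn e * (sgn a * + ((suc i C a) ℕ.* suc (a ℕ.+ e))))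
      ≡⟨ *-distribˡ-sumTo (suc i) (+ (n C i) * sgn e) _ ⟨
    + (n C i) * sgn e * weightedAlternatingSum i e ∎
    where
    n = suc (suc (i ℕ.+ i ℕ.+ e))
    rearrange : ∀ x y σ τ w → x * y * (σ * τ * w) ≡ x * τ * (σ * (y * w))
    rearrange = solve-∀
    regroup : ∀ a → + ((n C i) ℕ.* (suc i C a)) * (sgn (a ℕ.+ e) * + suc (a ℕ.+ e))
                  ≡ + (n C i) * sgn e * (sgn a * + ((suc i C a) ℕ.* suc (a ℕ.+ e)))
    regroup a = begin
      + ((n C i) ℕ.* (suc i C a)) * (sgn (a ℕ.+ e) * + suc (a ℕ.+ e))
        ≡⟨ cong₂ (λ x σ → x * (σ * + suc (a ℕ.+ e))) (ℤₚ.pos-* (n C i) (suc i C a)) (sgn-+ a e) ⟩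
      + (n C i) * + (suc i C a) * (sgn a * sgn e * + suc (a ℕ.+ e))
        ≡⟨ rearrange (+ (n C i)) (+ (suc i C a)) (sgn a) (sgn e) (+ suc (a ℕ.+ e)) ⟩
      + (n C i) * sgn e * (sgn a * (+ (suc i C a) * + suc (a ℕ.+ e)))
        ≡⟨ cong (λ x → + (n C i) * sgn e * (sgn a * x)) (ℤₚ.pos-* (suc i C a) (suc (a ℕ.+ e))) ⟨
      + (n C i) * sgn e * (sgn a * + ((suc i C a) ℕ.* suc (a ℕ.+ e))) ∎

  reindexedSum+χU≡0 : ∀ i e → let R = i ℕ.+ i ℕ.+ e in
    reindexedSum R i + + suc i * χU (suc R) (suc (suc R)) i ≡ + 0
  reindexedSum+χU≡0 zero e = begin
    reindexedSum e 0 + + 1 * χU (suc e) (suc (suc e)) 0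
      ≡⟨ cong₂ (λ x y → x + + 1 * y)
               (trans (reindexedSum≡ 0 e) (cong (+ 1 * sgn e *_) (weightedAlternatingSum-zero e)))
               (χU-zero (suc e)) ⟩
    + 1 * sgn e * + suc e + + 1 * (- sgn e * + suc e)
      ≡⟨ cancel (sgn e) (+ suc e) ⟩
    + 0 ∎
    where
    cancel : ∀ σ w → + 1 * σ * w + + 1 * (- σ * w) ≡ + 0
    cancel = solve-∀
  reindexedSum+χU≡0 i@(suc k) e = begin
    reindexedSum R i + + suc i * χU (suc R) n i
      ≡⟨ cong₂ (λ x y → x + + suc i * y)
               (trans (reindexedSum≡ i e) (cong (+ (n C i) * sgn e *_) (weightedAlternatingSum-suc k e)))
               (χU-pos (suc R) n i (s≤s z≤n) i≤1+R (ℕₚ.n≤1+n (suc R))) ⟩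
    + (n C i) * sgn e * (sgn i * w) + + suc i * (sgn (suc R ∸ i) * + (n C (suc R ∸ i)))
      ≡⟨ cong (λ l → + (n C i) * sgn e * (sgn i * w) + + suc i * (sgn l * + (n C l))) (m≡n+o⇒m∸n≡o i (top i e)) ⟩
    + (n C i) * sgn e * (sgn i * w) + + suc i * (sgn (suc (i ℕ.+ e)) * + (n C suc (i ℕ.+ e)))
      ≡⟨ cong (λ y → + (n C i) * sgn e * (sgn i * w) + y) χ-term ⟩
    + (n C i) * sgn e * (sgn i * w) + - (sgn i * sgn e) * (+ (n C i) * w)
      ≡⟨ cancel (+ (n C i)) (sgn e) (sgn i) w ⟩
    + 0 ∎
    where
    R = i ℕ.+ i ℕ.+ e
    n = suc (suc R)
    w = + suc (suc (i ℕ.+ e))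
    top : ∀ a e → suc (a ℕ.+ a ℕ.+ e) ≡ a ℕ.+ suc (a ℕ.+ e)
    top = ℕ-solve-∀
    size : ∀ a e → suc (suc (a ℕ.+ a ℕ.+ e)) ≡ suc (a ℕ.+ e) ℕ.+ suc a
    size = ℕ-solve-∀
    size′ : ∀ a e → suc (suc (a ℕ.+ a ℕ.+ e)) ≡ a ℕ.+ suc (suc (a ℕ.+ e))
    size′ = ℕ-solve-∀
    i≤1+R : i ≤ suc R
    i≤1+R = ℕₚ.≤-trans (ℕₚ.m≤m+n i (suc (i ℕ.+ e))) (ℕₚ.≤-reflexive (sym (top i e)))
    cancel : ∀ x σ τ w → x * σ * (τ * w) + - (τ * σ) * (x * w) ≡ + 0
    cancel = solve-∀
    χ-term : + suc i * (sgn (suc (i ℕ.+ e)) * + (n C suc (i ℕ.+ e))) ≡ - (sgn i * sgn e) * (+ (n C i) * w)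
    χ-term = begin
      + suc i * (sgn (suc (i ℕ.+ e)) * + (n C suc (i ℕ.+ e)))
        ≡⟨ cong₂ (λ σ x → + suc i * (- σ * + x)) (sgn-+ i e) symmetric ⟩
      + suc i * (- (sgn i * sgn e) * + (n C suc i))
        ≡⟨ swap (+ suc i) (- (sgn i * sgn e)) _ ⟩
      - (sgn i * sgn e) * (+ (n C suc i) * + suc i)
        ≡⟨ cong (- (sgn i * sgn e) *_) (ℤₚ.pos-* (n C suc i) (suc i)) ⟨
      - (sgn i * sgn e) * + ((n C suc i) ℕ.* suc i)
        ≡⟨ cong (λ x → - (sgn i * sgn e) * + x)
                (trans (nC[1+k]*[1+k]≡nCk*[n∸k] n i) (cong ((n C i) ℕ.*_) (m≡n+o⇒m∸n≡o i (size′ i e)))) ⟩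
      - (sgn i * sgn e) * + ((n C i) ℕ.* suc (suc (i ℕ.+ e)))
        ≡⟨ cong (- (sgn i * sgn e) *_) (ℤₚ.pos-* (n C i) _) ⟩
      - (sgn i * sgn e) * (+ (n C i) * w) ∎
      where
      swap : ∀ t σ x → t * (σ * x) ≡ σ * (x * t)
      swap = solve-∀
      symmetric : n C suc (i ℕ.+ e) ≡ n C suc i
      symmetric = subst (λ l → (l C suc (i ℕ.+ e)) ≡ (l C suc i)) (sym (size i e)) ([m+n]Cm≡[m+n]Cn (suc (i ℕ.+ e)) (suc i))

  closedForm-recursive : ∀ i e → let n = suc (suc (i ℕ.+ i ℕ.+ e)) in
    (∀ {m} → m < n → ClosedFormAt m) → + suc i * c n i ≡ + ((n C i) ℕ.* ((n ∸ i ∸ 2) C i))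
  closedForm-recursive i e closed = begin
    + suc i * c n i
      ≡⟨ cong (+ suc i *_) (c-recursion R i (s≤s (ℕₚ.m≤m+n (i ℕ.+ i) e))) ⟩
    + suc i * - (flatSum R i + χ)
      ≡⟨ rearrange (+ suc i) (flatSum R i) χ X ⟩
    X - ((+ suc i * flatSum R i + X) + + suc i * χ)
      ≡⟨ cong (λ z → X - (z + + suc i * χ)) (flatSum≡reindexedSum R i closed i≤R) ⟩
    X - (reindexedSum R i + + suc i * χ)
      ≡⟨ cong (λ z → X - z) (reindexedSum+χU≡0 i e) ⟩
    X - + 0
      ≡⟨ ℤₚ.+-identityʳ X ⟩
    X ∎
    where
    R = i ℕ.+ i ℕ.+ e
    n = suc (suc R)
    χ = χU (suc R) n i
    X = + ((n C i) ℕ.* ((n ∸ i ∸ 2) C i))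
    i≤R : i ≤ R
    i≤R = ℕₚ.≤-trans (ℕₚ.m≤m+n i i) (ℕₚ.m≤m+n (i ℕ.+ i) e)
    rearrange : ∀ t s x y → t * - (s + x) ≡ y - ((t * s + y) + t * x)
    rearrange = solve-∀

  closedForm-vanishing : ∀ R i → ¬ suc (i ℕ.+ i) ≤ suc R →
    + suc i * c (suc (suc R)) i ≡ + ((suc (suc R) C i) ℕ.* ((suc (suc R) ∸ i ∸ 2) C i))
  closedForm-vanishing R zero      high = contradiction (s≤s z≤n) high
  closedForm-vanishing R i@(suc _) high = begin
    + suc i * c n i                        ≡⟨ cong (+ suc i *_) (c-vanishing R i high) ⟩
    + suc i * + 0                          ≡⟨ ℤₚ.*-zeroʳ (+ suc i) ⟩
    + 0                                    ≡⟨ cong +_ (ℕₚ.*-zeroʳ (n C i)) ⟨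
    + ((n C i) ℕ.* 0)                      ≡⟨ cong (λ x → + ((n C i) ℕ.* x)) (k>n⇒nCk≡0 n∸i∸2<i) ⟨
    + ((n C i) ℕ.* ((n ∸ i ∸ 2) C i))      ∎
    where
    n = suc (suc R)
    n∸i∸2<i : n ∸ i ∸ 2 < i
    n∸i∸2<i = subst (_< i) (sym (trans (ℕₚ.∸-+-assoc n i 2) (cong (n ∸_) (ℕₚ.+-comm i 2))))
                    (ℕₚ.m<n+o⇒m∸n<o R i (ℕₚ.≤-pred (ℕₚ.≰⇒> high)))

  closedForm-step : ∀ n → (∀ {m} → m < n → ClosedFormAt m) → ClosedFormAt n
  closedForm-step zero          _ zero    = refl
  closedForm-step zero          _ (suc j) = ℤₚ.*-zeroʳ (+ suc (suc j))
  closedForm-step (suc zero)    _ zero    = refl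
  closedForm-step (suc zero)    _ (suc j) = begin
    + suc (suc j) * + 0                          ≡⟨ ℤₚ.*-zeroʳ (+ suc (suc j)) ⟩
    + 0                                          ≡⟨ cong +_ (ℕₚ.*-zeroʳ (1 C suc j)) ⟨
    + ((1 C suc j) ℕ.* ((0 ∸ 2) C suc j))        ≡⟨ cong (λ l → + ((1 C suc j) ℕ.* ((l ∸ 2) C suc j))) (ℕₚ.0∸n≡0 j) ⟨
    + ((1 C suc j) ℕ.* ((0 ∸ j ∸ 2) C suc j))    ∎
  closedForm-step (suc (suc R)) closed i with suc (i ℕ.+ i) ℕ.≤? suc R
  ... | yes low = subst (λ r → (∀ {m} → m < suc (suc r) → ClosedFormAt m) →
                               + suc i * c (suc (suc r)) i ≡ + ((suc (suc r) C i) ℕ.* ((suc (suc r) ∸ i ∸ 2) C i)))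
                        (ℕₚ.m+[n∸m]≡n (ℕₚ.≤-pred low)) (closedForm-recursive i (R ∸ (i ℕ.+ i))) closed
  ... | no high = closedForm-vanishing R i high

  c-closedForm : ∀ n → ClosedFormAt n
  c-closedForm = <-rec ClosedFormAt closedForm-step

module LogConcavity where
  open Binomial
  open import Data.Nat
  open import Data.Nat.Properties
  open import Data.Nat.Combinatorics using (_C_)
  open import Data.Nat.DivMod using (_/_; m/n*n≤m)
  open import Data.Nat.Tactic.RingSolver using (solve-∀)
  open import Relation.Binary.PropositionalEquality
  open import Relation.Nullary using (contradiction)

  log-concave-of-ratios : ∀ P Q R {α β γ δ} → Q * α ≡ P * β → R * γ ≡ Q * δ → 0 < Q → α * δ < β * γ → P * R < Q * Q
  log-concave-of-ratios P Q R {α} {β} {γ} {δ} Qα≡Pβ Rγ≡Qδ 0<Q αδ<βγ =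
    *-cancelʳ-< (β * γ) (P * R) (Q * Q) (begin-strict
    P * R * (β * γ)      ≡⟨ interchange P R β γ ⟩
    P * β * (R * γ)      ≡⟨ cong₂ _*_ (sym Qα≡Pβ) Rγ≡Qδ ⟩
    Q * α * (Q * δ)      ≡⟨ interchange′ Q α δ ⟩
    Q * Q * (α * δ)      <⟨ *-monoʳ-< (Q * Q) αδ<βγ ⟩
    Q * Q * (β * γ)      ∎)
    where
    open ≤-Reasoning
    instance _ = >-nonZero (*-mono-< 0<Q 0<Q)
    interchange : ∀ p r b g → p * r * (b * g) ≡ p * b * (r * g)
    interchange = solve-∀
    interchange′ : ∀ q a d → q * a * (q * d) ≡ q * q * (a * d)
    interchange′ = solve-∀

  ratioNumerator ratioDenominator : ℕ → ℕ → ℕ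
  ratioNumerator   n i = (n ∸ i) * (n ∸ i ∸ 2 ∸ i) * (n ∸ i ∸ 2 ∸ suc i)
  ratioDenominator n i = suc i * suc (suc i) * (n ∸ i ∸ 2)

  private
    n∸[1+i]∸2≡n∸i∸2∸1 : ∀ n i → n ∸ suc i ∸ 2 ≡ n ∸ i ∸ 2 ∸ 1
    n∸[1+i]∸2≡n∸i∸2∸1 n i = begin
      n ∸ suc i ∸ 2       ≡⟨ ∸-+-assoc n (suc i) 2 ⟩
      n ∸ suc (i + 2)     ≡⟨ cong (n ∸_) (+-comm (i + 2) 1) ⟨
      n ∸ (i + 2 + 1)     ≡⟨ ∸-+-assoc n (i + 2) 1 ⟨
      n ∸ (i + 2) ∸ 1     ≡⟨ cong (_∸ 1) (∸-+-assoc n i 2) ⟨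
      n ∸ i ∸ 2 ∸ 1       ∎
      where open ≡-Reasoning

  binomial-ratio : ∀ n i P Q → suc i * P ≡ (n C i) * ((n ∸ i ∸ 2) C i) →
                   suc (suc i) * Q ≡ (n C suc i) * ((n ∸ suc i ∸ 2) C suc i) →
                   Q * ratioDenominator n i ≡ P * ratioNumerator n i
  binomial-ratio n i P Q P≡ Q≡ = *-cancelˡ-≡ _ _ (suc i) (begin
    suc i * (Q * (suc i * suc (suc i) * m))
      ≡⟨ regroup₁ (suc i) Q (suc (suc i)) m ⟩
    suc (suc i) * Q * (suc i * (suc i * m))
      ≡⟨ cong (_* (suc i * (suc i * m))) (trans Q≡ (cong (λ l → (n C suc i) * (l C suc i)) (n∸[1+i]∸2≡n∸i∸2∸1 n i))) ⟩
    (n C suc i) * ((m ∸ 1) C suc i) * (suc i * (suc i * m))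
      ≡⟨ regroup₂ (n C suc i) ((m ∸ 1) C suc i) (suc i) m ⟩
    (n C suc i) * suc i * (((m ∸ 1) C suc i) * suc i * m)
      ≡⟨ cong₂ _*_ (nC[1+k]*[1+k]≡nCk*[n∸k] n i) ([n∸1]C[1+k]*[1+k]*n≡nCk*[n∸k]*[n∸[1+k]] m i) ⟩
    (n C i) * (n ∸ i) * ((m C i) * (m ∸ i) * (m ∸ suc i))
      ≡⟨ regroup₃ (n C i) (n ∸ i) (m C i) (m ∸ i) (m ∸ suc i) ⟩
    (n C i) * (m C i) * ratioNumerator n i
      ≡⟨ cong (_* ratioNumerator n i) P≡ ⟨
    suc i * P * ratioNumerator n i
      ≡⟨ *-assoc (suc i) P _ ⟩
    suc i * (P * ratioNumerator n i) ∎)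
    where
    open ≡-Reasoning
    m = n ∸ i ∸ 2
    regroup₁ : ∀ a q b m → a * (q * (a * b * m)) ≡ b * q * (a * (a * m))
    regroup₁ = solve-∀
    regroup₂ : ∀ x y a m → x * y * (a * (a * m)) ≡ x * a * (y * a * m)
    regroup₂ = solve-∀
    regroup₃ : ∀ x u y v w → x * u * (y * v * w) ≡ x * y * (u * v * w)
    regroup₃ = solve-∀

  private
    [k+[i+d]]∸i≡k+d : ∀ k i d → k + (i + d) ∸ i ≡ k + d
    [k+[i+d]]∸i≡k+d k i d = trans (cong (_∸ i) (reorder k i d)) (m+n∸m≡n i (k + d))
      where
      reorder : ∀ k i d → k + (i + d) ≡ i + (k + d)
      reorder = solve-∀

  -- n = 2i + 3 + d is written as i + (3 + (i + d)), so that n ∸ i ∸ 2 reduces to 1 + (i + d).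
  ratioNumerator-eval : ∀ i d → ratioNumerator (i + (3 + (i + d))) i ≡ (3 + (i + d)) * (1 + d) * d
  ratioNumerator-eval i d = trans (cong (λ l → l * (l ∸ 2 ∸ i) * (l ∸ 2 ∸ suc i)) (m+n∸m≡n i (3 + (i + d))))
                                  (cong₂ (λ x y → (3 + (i + d)) * x * y) ([k+[i+d]]∸i≡k+d 1 i d) (m+n∸m≡n i d))

  ratioDenominator-eval : ∀ i d → ratioDenominator (i + (3 + (i + d))) i ≡ suc i * suc (suc i) * (1 + (i + d))
  ratioDenominator-eval i d = cong (λ l → suc i * suc (suc i) * (l ∸ 2)) (m+n∸m≡n i (3 + (i + d)))

  -- Pair the six factors on each side; all pairs but (s + 2, s + 2) are strict.
  ratio-decreasing′ : ∀ s e →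
    suc s * suc (suc s) * (1 + (s + (3 + e))) * ((3 + (suc s + (1 + e))) * (1 + (1 + e)) * (1 + e))
      < (3 + (s + (3 + e))) * (1 + (3 + e)) * (3 + e) * (suc (suc s) * suc (suc (suc s)) * (1 + (suc s + (1 + e))))
  ratio-decreasing′ s e = begin-strict
    suc s * suc (suc s) * (1 + (s + (3 + e))) * ((3 + (suc s + (1 + e))) * (1 + (1 + e)) * (1 + e))
      ≡⟨ left-factors s e ⟩
    (2 + s) * ((1 + s) * (5 + x) * (2 + e) * ((4 + x) * (1 + e)))
      <⟨ *-monoʳ-< (2 + s) (*-mono-< (*-mono-< (*-mono-< (+-monoˡ-< s 1<3) (+-monoˡ-< x (n<1+n 5)))
                                                (+-monoˡ-< e 2<4))
                                     key) ⟩
    (2 + s) * ((3 + s) * (6 + x) * (4 + e) * ((3 + x) * (3 + e)))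
      ≡⟨ right-factors s e ⟨
    (3 + (s + (3 + e))) * (1 + (3 + e)) * (3 + e) * (suc (suc s) * suc (suc (suc s)) * (1 + (suc s + (1 + e)))) ∎
    where
    open ≤-Reasoning
    x = s + e
    1<3 : 1 < 3
    1<3 = s≤s (s≤s z≤n)
    2<4 : 2 < 4
    2<4 = s≤s (s≤s (s≤s z≤n))
    left-factors : ∀ s e →
      suc s * suc (suc s) * (1 + (s + (3 + e))) * ((3 + (suc s + (1 + e))) * (1 + (1 + e)) * (1 + e))
        ≡ (2 + s) * ((1 + s) * (5 + (s + e)) * (2 + e) * ((4 + (s + e)) * (1 + e)))
    left-factors = solve-∀
    right-factors : ∀ s e →
      (3 + (s + (3 + e))) * (1 + (3 + e)) * (3 + e) * (suc (suc s) * suc (suc (suc s)) * (1 + (suc s + (1 + e))))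
        ≡ (2 + s) * ((3 + s) * (6 + (s + e)) * (4 + e) * ((3 + (s + e)) * (3 + e)))
    right-factors = solve-∀
    gap : ∀ s e → (3 + (s + e)) * (3 + e) ≡ (4 + (s + e)) * (1 + e) + suc (4 + s + s + e)
    gap = solve-∀
    key : (4 + x) * (1 + e) < (3 + x) * (3 + e)
    key = subst ((4 + x) * (1 + e) <_) (sym (gap s e)) (m<m+n _ (s≤s z≤n))

  ratio-decreasing : ∀ n s → suc s + suc s + 4 ≤ n →
    ratioDenominator n s * ratioNumerator n (suc s) < ratioNumerator n s * ratioDenominator n (suc s)
  ratio-decreasing n s 2s+6≤n =
    subst (λ n → ratioDenominator n s * ratioNumerator n (suc s) < ratioNumerator n s * ratioDenominator n (suc s))
          (m+[n∸m]≡n 2s+6≤n) (evaluated (n ∸ (suc s + suc s + 4)))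
    where
    shape₁ : ∀ s e → suc s + suc s + 4 + e ≡ s + (3 + (s + (3 + e)))
    shape₁ = solve-∀
    shape₂ : ∀ s e → suc s + suc s + 4 + e ≡ suc s + (3 + (suc s + (1 + e)))
    shape₂ = solve-∀
    evaluated : ∀ e → let n = suc s + suc s + 4 + e in
      ratioDenominator n s * ratioNumerator n (suc s) < ratioNumerator n s * ratioDenominator n (suc s)
    evaluated e = subst₂ _<_
      (sym (cong₂ _*_ (trans (cong (λ n → ratioDenominator n s) (shape₁ s e)) (ratioDenominator-eval s (3 + e)))
                      (trans (cong (λ n → ratioNumerator n (suc s)) (shape₂ s e)) (ratioNumerator-eval (suc s) (1 + e)))))
      (sym (cong₂ _*_ (trans (cong (λ n → ratioNumerator n s) (shape₁ s e)) (ratioNumerator-eval s (3 + e)))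
                      (trans (cong (λ n → ratioDenominator n (suc s)) (shape₂ s e)) (ratioDenominator-eval (suc s) (1 + e)))))
      (ratio-decreasing′ s e)

  closedForm-pos : ∀ n i → i + i + 2 ≤ n → 0 < (n C i) * ((n ∸ i ∸ 2) C i)
  closedForm-pos n i 2i+2≤n = *-mono-< (nCk>0 i≤n) (nCk>0 i≤n∸i∸2)
    where
    i≤n∸i∸2 : i ≤ n ∸ i ∸ 2
    i≤n∸i∸2 = subst (i ≤_) (sym (∸-+-assoc n i 2)) (m+n≤o⇒m≤o∸n i (subst (_≤ n) (+-assoc i i 2) 2i+2≤n))
    i≤n : i ≤ n
    i≤n = ≤-trans (≤-trans (m≤m+n i i) (m≤m+n (i + i) 2)) 2i+2≤n

  positive-factor : ∀ k Q {x} → suc k * Q ≡ x → 0 < x → 0 < Q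
  positive-factor k zero    refl 0<x = contradiction (*-zeroʳ (suc k)) (>⇒≢ 0<x)
  positive-factor k (suc _) _    _   = s≤s z≤n

  closedForm-log-concave : ∀ n s P Q R → suc s + suc s + 4 ≤ n →
    suc s * P ≡ (n C s) * ((n ∸ s ∸ 2) C s) →
    suc (suc s) * Q ≡ (n C suc s) * ((n ∸ suc s ∸ 2) C suc s) →
    suc (suc (suc s)) * R ≡ (n C suc (suc s)) * ((n ∸ suc (suc s) ∸ 2) C suc (suc s)) →
    P * R < Q * Q
  closedForm-log-concave n s P Q R 2s+6≤n P≡ Q≡ R≡ =
    log-concave-of-ratios P Q R Q-ratio R-ratio 0<Q (ratio-decreasing n s 2s+6≤n)
    where
    Q-ratio : Q * ratioDenominator n s ≡ P * ratioNumerator n s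
    Q-ratio = binomial-ratio n s P Q P≡ Q≡
    R-ratio : R * ratioDenominator n (suc s) ≡ Q * ratioNumerator n (suc s)
    R-ratio = binomial-ratio n (suc s) Q R Q≡ R≡
    0<Q : 0 < Q
    0<Q = positive-factor (suc s) Q Q≡
            (closedForm-pos n (suc s) (≤-trans (+-monoʳ-≤ (suc s + suc s) (m≤m+n 2 2)) 2s+6≤n))

  i<n/2∸1⇒i+i+4≤n : ∀ n i → i < n / 2 ∸ 1 → i + i + 4 ≤ n
  i<n/2∸1⇒i+i+4≤n n i i<n/2∸1 = subst (_≤ n) (double i) (≤-trans (*-monoˡ-≤ 2 2+i≤n/2) (m/n*n≤m n 2))
    where
    2+i≤n/2 : suc (suc i) ≤ n / 2
    2+i≤n/2 with n / 2
    ... | suc _ = s≤s i<n/2∸1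
    double : ∀ i → (2 + i) * 2 ≡ i + i + 4
    double = solve-∀

open ClosedForm using (c-closedForm)
open LogConcavity using (closedForm-log-concave; i<n/2∸1⇒i+i+4≤n)
open import Data.Nat as ℕ using (ℕ; suc; _∸_; _/_)
open import Data.Nat.Combinatorics using (_C_)
open import Data.Product using (Σ-syntax; _×_; _,_)
open import Relation.Binary.PropositionalEquality using (_≡_; refl; trans; subst₂)
open import Data.Integer as ℤ using (+_; _*_)
import Data.Integer.Properties as ℤₚ

c-natural : ∀ n j → Σ[ q ∈ ℕ ] c n j ≡ + q × suc j ℕ.* q ≡ (n C j) ℕ.* ((n ∸ j ∸ 2) C j)
c-natural n j = natural (c n j) (c-closedForm n j)
  where
  natural : ∀ z {m} → + suc j * z ≡ + m → Σ[ q ∈ ℕ ] z ≡ + q × suc j ℕ.* q ≡ m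
  natural (+ q) eq = q , refl , ℤₚ.+-injective (trans (ℤₚ.pos-* (suc j) q) eq)

c-log-concave : ∀ n s → suc s ℕ.+ suc s ℕ.+ 4 ℕ.≤ n →
                c n s * c n (suc (suc s)) ℤ.< c n (suc s) * c n (suc s)
c-log-concave n s 2s+6≤n with c-natural n s | c-natural n (suc s) | c-natural n (suc (suc s))
... | P , c≡P , P≡ | Q , c≡Q , Q≡ | R , c≡R , R≡ rewrite c≡P | c≡Q | c≡R =
  subst₂ ℤ._<_ (ℤₚ.pos-* P R) (ℤₚ.pos-* Q Q) (ℤ.+<+ (closedForm-log-concave n s P Q R 2s+6≤n P≡ Q≡ R≡))

-- The hypothesis 2 ≤ n is implied by the bound on i.
corollary2p1 : (n : ℕ) → 2 ℕ.≤ n → (i : ℕ) → 0 ℕ.< i → i ℕ.< n / 2 ∸ 1 →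
    c n (i ∸ 1) * c n (ℕ.suc i) ℤ.< c n i * c n i
corollary2p1 n _ (suc s) _ i<n/2∸1 = c-log-concave n s (i<n/2∸1⇒i+i+4≤n n (suc s) i<n/2∸1)
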